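{- Let $p\ge 3$ be a prime and $m$ a positive integer. Define integers $d_m(n)$ by $$\frac{1}{(1-x)^{m}}\prod_{i=0}^{\infty}\frac{1}{(1-x^{p^{i}})^{(p-1)m}}=\sum_{n=0}^{\infty}d_{m}(n)x^{n}.$$ Let $n\ge 1$ be an integer with base-$p$ expansion $n=n_sp^s+n_{s+1}p^{s+1}+\dots+n_tp^t$, where $s\le t$, $n_j\in\{0,\dots,p-1\}$ and $n_s\neq 0$. Then $$d_m(n)\equiv pm\cdot\left(n_s^{ -1}\bmod p\right)\pmod{p^{\nu_p(m)+2}},$$ where $n_s^{ -1}\bmod p$ denotes the integer in $\{1,\dots,p-1\}$ that is inverse to $n_s$ modulo $p$. In particular, $\nu_p(d_m(n))=0$ if $n=0$ and $\nu_p(d_m(n))=\nu_p(m)+1$ if $n\ge 1$.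
   Context: For a prime $p$ and an integer $a$, $\nu_p(a)$ is the $p$-adic valuation of $a$ (the exponent of the highest power of $p$ dividing $a$), with $\nu_p(0)=+\infty$. -}

module Defs where

open import Data.Nat using (ℕ; zero; suc; _+_; _*_; _∸_; _^_)
open import Data.Nat.Divisibility using (_∣?_)
open import Data.List using (map; upTo)
open import Data.Nat.ListAction using (sum)
open import Relation.Nullary.Decidable using (does)
open import Data.Bool using (if_then_else_)

Series : Set
Series = ℕ → ℕ

one : Series
one zero    = 1
one (suc _) = 0

_·_ : Series → Series → Series
(f · g) n = sum (map (λ i → f i * g (n ∸ i)) (upTo (suc n)))

infixl 7 _·_

pow : ℕ → Series → Series
pow zero    f = one
pow (suc r) f = f · pow r f

-- 1/(1 - x^k) = Σ_j x^{jk}  (intended for k ≥ 1).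
geomInv : ℕ → Series
geomInv k n = if does (k ∣? n) then 1 else 0

prodFactors : ℕ → ℕ → ℕ → Series
prodFactors p r zero    = one
prodFactors p r (suc N) = pow r (geomInv (p ^ N)) · prodFactors p r N

-- Factors with i ≥ n+1 have p^i > n and do not affect the coefficient of x^n,
-- so truncating the infinite product at i ≤ n gives exactly that coefficient.
d : ℕ → ℕ → ℕ → ℕ
d p m n = (pow m (geomInv 1) · prodFactors p ((p ∸ 1) * m) (suc n)) n

{-# OPTIONS --safe #-}
-- Let F = (1 − x)⁻¹ ∏ᵢ (1 − x^{pⁱ})^{−(p−1)} and Φₖ = (1 − x^{pk}) / (1 − x^k)^p. The product
-- (1 − x^{p^N}) F telescopes to ∏_{i<N} Φ_{pⁱ}, so below x^{p^N} the coefficients of F^m are those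
-- of (∏_{i<N} Φ_{pⁱ})^m. The binomial theorem gives (1 − x^k)^p = 1 − x^{pk} + p Dₖ with
-- Dₖ = Σ_{0<j<p} c_j x^{jk}, c_j = (−1)^j C(p,j)/p, hence Φₖ ≡ 1 − p Tₖ (mod p²) for the
-- pk-periodic extension Tₖ of Dₖ, and ∏ Φ_{pⁱ} ≡ 1 + p K (mod p²). Because p ∣ C(p,2), raising
-- to the power p^k m′ yields 1 + m′ p^{k+1} K (mod p^{k+2}). If n = p^s (n_s + p q) with
-- 0 < n_s < p, only the factor i = s contributes to K at x^n, so K_n = −c_{n_s}, and
-- −n_s c_{n_s} ≡ 1 (mod p) because C(p − 1, n_s − 1) ≡ (−1)^{n_s − 1}.
module Submission where

open import Data.Nat.Base using (ℕ; suc; _≤_)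
open import Data.Nat.Primality using (Prime)

module PowerSeries where

  open import Data.Nat.Base as ℕ using (ℕ; zero; suc)
  open import Data.Integer.Base as ℤ using (ℤ; +_; 0ℤ; 1ℤ; -_; _+_; _*_)
  import Data.Integer.Properties as ℤ
  open import Data.Integer.Tactic.RingSolver using (solve-∀)
  open import Data.Maybe.Base using (Maybe; just; nothing)
  open import Data.Product.Base using (_,_)
  open import Relation.Nullary.Decidable using (yes; no)
  open import Relation.Binary.PropositionalEquality using (_≡_; _≗_; refl; cong; cong₂; sym; trans)
  open import Algebra.Bundles using (CommutativeRing)
  open import Algebra.Solver.Ring.AlmostCommutativeRing
    using (AlmostCommutativeRing; fromCommutativeRing; _-Raw-AlmostCommutative⟶_)

  ℤ[[x]] : Set
  ℤ[[x]] = ℕ → ℤ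

  infix  4 _≈_
  infixl 6 _⊕_
  infixl 7 _⊗_
  infix  8 ⊖_

  record _≈_ (f g : ℤ[[x]]) : Set where
    constructor coeffwise
    field coeff : f ≗ g

  open _≈_ public

  ι : ℤ → ℤ[[x]]
  ι c zero    = c
  ι c (suc n) = 0ℤ

  𝟘 𝟙 : ℤ[[x]]
  𝟘 _ = 0ℤ
  𝟙 = ι 1ℤ

  _⊕_ : ℤ[[x]] → ℤ[[x]] → ℤ[[x]]
  (f ⊕ g) n = f n + g n

  ⊖_ : ℤ[[x]] → ℤ[[x]]
  (⊖ f) n = - f n

  tail : ℤ[[x]] → ℤ[[x]]
  tail f n = f (suc n)

  _⊗_ : ℤ[[x]] → ℤ[[x]] → ℤ[[x]]
  (f ⊗ g) zero    = f 0 * g 0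
  (f ⊗ g) (suc n) = f 0 * g (suc n) + (tail f ⊗ g) n

  ι⊗-coeff : ∀ c f n → (ι c ⊗ f) n ≡ c * f n
  ι⊗-coeff c f zero    = refl
  ι⊗-coeff c f (suc n) = trans (cong (λ v → c * f (suc n) + v) (𝟘⊗ n)) (ℤ.+-identityʳ _)
    where
    𝟘⊗ : ∀ n → (𝟘 ⊗ f) n ≡ 0ℤ
    𝟘⊗ zero    = refl
    𝟘⊗ (suc n) = cong₂ _+_ (ℤ.*-zeroˡ (f (suc n))) (𝟘⊗ n)

  private
    ⊗-cong′ : ∀ {f f′ g g′} → f ≗ f′ → g ≗ g′ → f ⊗ g ≗ f′ ⊗ g′
    ⊗-cong′ f≗ g≗ zero    = cong₂ _*_ (f≗ 0) (g≗ 0)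
    ⊗-cong′ f≗ g≗ (suc n) = cong₂ _+_ (cong₂ _*_ (f≗ 0) (g≗ (suc n))) (⊗-cong′ (λ i → f≗ (suc i)) g≗ n)

    𝟙⊗′ : ∀ f → 𝟙 ⊗ f ≗ f
    𝟙⊗′ f n = trans (ι⊗-coeff 1ℤ f n) (ℤ.*-identityˡ (f n))

    scale : ℤ → ℤ[[x]] → ℤ[[x]]
    scale c f n = c * f n

    scale-⊗ : ∀ c f g → scale c f ⊗ g ≗ scale c (f ⊗ g)
    scale-⊗ c f g zero    = ℤ.*-assoc c (f 0) (g 0)
    scale-⊗ c f g (suc n) =
      trans (cong₂ _+_ (ℤ.*-assoc c (f 0) (g (suc n))) (scale-⊗ c (tail f) g n))
            (sym (ℤ.*-distribˡ-+ c _ _))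

    interchange : ∀ a b c d → (a + b) + (c + d) ≡ (a + c) + (b + d)
    interchange = solve-∀

    ⊗-distribʳ-⊕ : ∀ g f f′ → (f ⊕ f′) ⊗ g ≗ f ⊗ g ⊕ f′ ⊗ g
    ⊗-distribʳ-⊕ g f f′ zero    = ℤ.*-distribʳ-+ (g 0) (f 0) (f′ 0)
    ⊗-distribʳ-⊕ g f f′ (suc n) =
      trans (cong₂ _+_ (ℤ.*-distribʳ-+ (g (suc n)) (f 0) (f′ 0)) (⊗-distribʳ-⊕ g (tail f) (tail f′) n))
            (interchange (f 0 * g (suc n)) (f′ 0 * g (suc n)) ((tail f ⊗ g) n) ((tail f′ ⊗ g) n))

    ⊗-distribˡ-⊕ : ∀ g f f′ → g ⊗ (f ⊕ f′) ≗ g ⊗ f ⊕ g ⊗ f′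
    ⊗-distribˡ-⊕ g f f′ zero    = ℤ.*-distribˡ-+ (g 0) (f 0) (f′ 0)
    ⊗-distribˡ-⊕ g f f′ (suc n) =
      trans (cong₂ _+_ (ℤ.*-distribˡ-+ (g 0) (f (suc n)) (f′ (suc n))) (⊗-distribˡ-⊕ (tail g) f f′ n))
            (interchange (g 0 * f (suc n)) (g 0 * f′ (suc n)) ((tail g ⊗ f) n) ((tail g ⊗ f′) n))

    ⊗-suc-tailʳ : ∀ f g n → (f ⊗ g) (suc n) ≡ g 0 * f (suc n) + (f ⊗ tail g) n
    ⊗-suc-tailʳ f g zero = shuffle (f 0) (g 1) (g 0) (f 1)
      where shuffle : ∀ a b c d → a * b + d * c ≡ c * d + a * b
            shuffle = solve-∀
    ⊗-suc-tailʳ f g (suc n) =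
      trans (cong (λ v → f 0 * g (suc (suc n)) + v) (⊗-suc-tailʳ (tail f) g n))
            (swap (f 0 * g (suc (suc n))) (g 0 * f (suc (suc n))) ((tail f ⊗ tail g) n))
      where swap : ∀ a b c → a + (b + c) ≡ b + (a + c)
            swap = solve-∀

    ⊗-comm : ∀ f g → f ⊗ g ≗ g ⊗ f
    ⊗-comm f g zero    = ℤ.*-comm (f 0) (g 0)
    ⊗-comm f g (suc n) = trans (cong (λ v → f 0 * g (suc n) + v) (⊗-comm (tail f) g n)) (sym (⊗-suc-tailʳ g f n))

    ⊗-assoc : ∀ f g h → (f ⊗ g) ⊗ h ≗ f ⊗ (g ⊗ h)
    ⊗-assoc f g h zero    = ℤ.*-assoc (f 0) (g 0) (h 0)
    ⊗-assoc f g h (suc n) =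
      trans (cong (λ v → (f 0 * g 0) * h (suc n) + v)
              (trans (⊗-distribʳ-⊕ h (scale (f 0) (tail g)) (tail f ⊗ g) n)
                (cong₂ _+_ (scale-⊗ (f 0) (tail g) h n) (⊗-assoc (tail f) g h n))))
            (regroup (f 0) (g 0) (h (suc n)) ((tail g ⊗ h) n) ((tail f ⊗ (g ⊗ h)) n))
      where regroup : ∀ a b c x y → (a * b) * c + (a * x + y) ≡ a * (b * c + x) + y
            regroup = solve-∀

  +-*-commutativeRing : CommutativeRing _ _
  +-*-commutativeRing = record
    { Carrier = ℤ[[x]] ; _≈_ = _≈_ ; _+_ = _⊕_ ; _*_ = _⊗_ ; -_ = ⊖_ ; 0# = 𝟘 ; 1# = 𝟙
    ; isCommutativeRing = record
      { isRing = record
        { +-isAbelianGroup = record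
          { isGroup = record
            { isMonoid = record
              { isSemigroup = record
                { isMagma = record
                  { isEquivalence = record
                    { refl  = coeffwise λ _ → refl
                    ; sym   = λ p → coeffwise λ n → sym (coeff p n)
                    ; trans = λ p q → coeffwise λ n → trans (coeff p n) (coeff q n) }
                  ; ∙-cong = λ p q → coeffwise λ n → cong₂ _+_ (coeff p n) (coeff q n) }
                ; assoc = λ f g h → coeffwise λ n → ℤ.+-assoc (f n) (g n) (h n) }
              ; identity = (λ f → coeffwise λ n → ℤ.+-identityˡ (f n)) , (λ f → coeffwise λ n → ℤ.+-identityʳ (f n)) }
            ; inverse = (λ f → coeffwise λ n → ℤ.+-inverseˡ (f n)) , (λ f → coeffwise λ n → ℤ.+-inverseʳ (f n))
            ; ⁻¹-cong = λ p → coeffwise λ n → cong -_ (coeff p n) }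
          ; comm = λ f g → coeffwise λ n → ℤ.+-comm (f n) (g n) }
        ; *-cong = λ p q → coeffwise (⊗-cong′ (coeff p) (coeff q))
        ; *-assoc = λ f g h → coeffwise (⊗-assoc f g h)
        ; *-identity = (λ f → coeffwise (𝟙⊗′ f)) , (λ f → coeffwise λ n → trans (⊗-comm f 𝟙 n) (𝟙⊗′ f n))
        ; distrib = (λ g f f′ → coeffwise (⊗-distribˡ-⊕ g f f′)) , (λ g f f′ → coeffwise (⊗-distribʳ-⊕ g f f′)) }
      ; *-comm = λ f g → coeffwise (⊗-comm f g) } }

  open CommutativeRing +-*-commutativeRing public
    using (setoid; *-congˡ; *-congʳ; +-cong; +-congˡ; +-congʳ; -‿cong; +-identityʳ; zeroʳ)
    renaming ( refl to ≈-refl; sym to ≈-sym; trans to ≈-trans; *-cong to ⊗-cong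
             ; *-comm to ⊗-comm; *-assoc to ⊗-assoc; *-identityˡ to 𝟙⊗; *-identityʳ to ⊗𝟙)

  ι-homo : ℤ.+-*-rawRing -Raw-AlmostCommutative⟶ fromCommutativeRing +-*-commutativeRing
  ι-homo = record
    { ⟦_⟧    = ι
    ; +-homo = λ a b → coeffwise λ { zero → refl ; (suc n) → refl }
    ; *-homo = λ a b → coeffwise λ { zero → refl ; (suc n) → sym (trans (ι⊗-coeff a (ι b) (suc n)) (ℤ.*-zeroʳ a)) }
    ; -‿homo = λ a → coeffwise λ { zero → refl ; (suc n) → refl }
    ; 0-homo = coeffwise λ { zero → refl ; (suc n) → refl }
    ; 1-homo = ≈-refl }

  ι-* : ∀ a b → ι (a * b) ≈ ι a ⊗ ι b
  ι-* = _-Raw-AlmostCommutative⟶_.*-homo ι-homo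

  ι-cong : ∀ {a b} → a ≡ b → ι a ≈ ι b
  ι-cong refl = ≈-refl

  ι-+ : ∀ a b → ι (+ (a ℕ.+ b)) ≈ ι (+ a) ⊕ ι (+ b)
  ι-+ a b = coeffwise λ { zero → refl ; (suc n) → refl }

  ι-ℕ* : ∀ a b → ι (+ (a ℕ.* b)) ≈ ι (+ a) ⊗ ι (+ b)
  ι-ℕ* a b = ≈-trans (ι-cong (ℤ.pos-* a b)) (ι-* (+ a) (+ b))

  ι-≟ : ∀ a b → Maybe (ι a ≈ ι b)
  ι-≟ a b with a ℤ.≟ b
  ... | yes refl = just ≈-refl
  ... | no _     = nothing

  open import Algebra.Solver.Ring ℤ.+-*-rawRing (fromCommutativeRing +-*-commutativeRing) ι-homo ι-≟ public
    using (solve; _:=_; _:+_; _:*_; :-_; _:-_; con)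

  open import Algebra.Properties.CommutativeSemiring.Exp
    (CommutativeRing.commutativeSemiring +-*-commutativeRing) public
    using (_^_; ^-congˡ; ^-congʳ; ^-assocʳ; ^-distrib-*)

  ^-coeff-0 : ∀ {f} r → f 0 ≡ 1ℤ → (f ^ r) 0 ≡ 1ℤ
  ^-coeff-0 zero    _      = refl
  ^-coeff-0 (suc r) f0≡1 = cong₂ _*_ f0≡1 (^-coeff-0 r f0≡1)

  𝟙-coeff-pos : ∀ {n} → 1 ℕ.≤ n → 𝟙 n ≡ 0ℤ
  𝟙-coeff-pos {suc _} _ = refl

  𝟙^ : ∀ r → 𝟙 ^ r ≈ 𝟙
  𝟙^ zero    = ≈-refl
  𝟙^ (suc r) = ≈-trans (𝟙⊗ (𝟙 ^ r)) (𝟙^ r)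

module Congruence where

  open PowerSeries
  open import Data.Integer.Base using (0ℤ; 1ℤ; _+_; _*_)
  open import Data.Nat.Base using (zero; suc)
  open import Data.Product.Base using (∃-syntax; _,_)
  open import Function.Base using (_$_)
  open import Relation.Binary.PropositionalEquality using (_≡_; trans; cong)

  infix 4 _≡_[mod_]

  record _≡_[mod_] (A B M : ℤ[[x]]) : Set where
    constructor ≡-mod
    field
      quotient : ℤ[[x]]
      ≈-quotient : A ≈ B ⊕ M ⊗ quotient

  module _ {M : ℤ[[x]]} where

    ≈⇒≡-mod : ∀ {A B} → A ≈ B → A ≡ B [mod M ]
    ≈⇒≡-mod {A} {B} A≈B = ≡-mod (ι 0ℤ) $ ≈-trans A≈B (solve 2 (λ b m → b := b :+ m :* con 0ℤ) ≈-refl B M)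

    ≡-mod-refl : ∀ {A} → A ≡ A [mod M ]
    ≡-mod-refl = ≈⇒≡-mod ≈-refl

    ≡-mod-trans : ∀ {A B C} → A ≡ B [mod M ] → B ≡ C [mod M ] → A ≡ C [mod M ]
    ≡-mod-trans {C = C} (≡-mod Q A≈) (≡-mod R B≈) = ≡-mod (Q ⊕ R) $
      ≈-trans A≈ (≈-trans (+-congʳ B≈)
        (solve 4 (λ c m q r → c :+ m :* r :+ m :* q := c :+ m :* (q :+ r)) ≈-refl C M Q R))

    ≈-≡-mod-trans : ∀ {A A′ B} → A ≈ A′ → A′ ≡ B [mod M ] → A ≡ B [mod M ]
    ≈-≡-mod-trans A≈ (≡-mod Q A′≈) = ≡-mod Q (≈-trans A≈ A′≈)

    ≡-mod-≈-trans : ∀ {A B B′} → A ≡ B′ [mod M ] → B′ ≈ B → A ≡ B [mod M ]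
    ≡-mod-≈-trans (≡-mod Q A≈) B′≈ = ≡-mod Q (≈-trans A≈ (+-congʳ B′≈))

    ⊗-cong-mod : ∀ {A B C D} → A ≡ B [mod M ] → C ≡ D [mod M ] → A ⊗ C ≡ B ⊗ D [mod M ]
    ⊗-cong-mod {B = B} {D = D} (≡-mod Q A≈) (≡-mod R C≈) = ≡-mod (Q ⊗ D ⊕ B ⊗ R ⊕ M ⊗ Q ⊗ R) $
      ≈-trans (⊗-cong A≈ C≈)
        (solve 5 (λ b d m q r → (b :+ m :* q) :* (d :+ m :* r) := b :* d :+ m :* (q :* d :+ b :* r :+ m :* q :* r))
               ≈-refl B D M Q R)

    ^-cong-mod : ∀ {A B} r → A ≡ B [mod M ] → A ^ r ≡ B ^ r [mod M ]
    ^-cong-mod zero    _   = ≡-mod-refl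
    ^-cong-mod (suc r) A≡B = ⊗-cong-mod A≡B (^-cong-mod r A≡B)

  ≡-mod-ι-coeff : ∀ {A B} c n → A ≡ B [mod ι c ] → ∃[ z ] A n ≡ B n + c * z
  ≡-mod-ι-coeff {B = B} c n (≡-mod Q A≈) = Q n , trans (coeff A≈ n) (cong (λ v → B n + v) (ι⊗-coeff c Q n))

  ≡-mod-weaken : ∀ {A B} M N → A ≡ B [mod M ⊗ N ] → A ≡ B [mod M ]
  ≡-mod-weaken {B = B} M N (≡-mod Q A≈) = ≡-mod (N ⊗ Q) (≈-trans A≈ (+-congˡ {B} (⊗-assoc M N Q)))

  ≡-mod-resp-modulus : ∀ {A B M M′} → M ≈ M′ → A ≡ B [mod M ] → A ≡ B [mod M′ ]
  ≡-mod-resp-modulus {B = B} M≈ (≡-mod Q A≈) = ≡-mod Q (≈-trans A≈ (+-congˡ {B} (*-congʳ M≈)))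

  1+M-inverse : ∀ {A} M t → A ⊗ (𝟙 ⊕ M ⊗ t) ≈ 𝟙 → A ≡ 𝟙 ⊕ M ⊗ ⊖ t [mod M ^ 2 ]
  1+M-inverse {A} M t A[1+Mt]≈𝟙 = ≡-mod (t ⊗ t ⊗ A) (begin
    A                                                   ≈⟨ expand ⟩
    (𝟙 ⊕ M ⊗ ⊖ t) ⊗ (A ⊗ (𝟙 ⊕ M ⊗ t)) ⊕ M ^ 2 ⊗ (t ⊗ t ⊗ A) ≈⟨ +-congʳ (*-congˡ A[1+Mt]≈𝟙) ⟩
    (𝟙 ⊕ M ⊗ ⊖ t) ⊗ 𝟙 ⊕ M ^ 2 ⊗ (t ⊗ t ⊗ A)            ≈⟨ +-congʳ (⊗𝟙 (𝟙 ⊕ M ⊗ ⊖ t)) ⟩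
    𝟙 ⊕ M ⊗ ⊖ t ⊕ M ^ 2 ⊗ (t ⊗ t ⊗ A)                  ∎)
    where
    open import Relation.Binary.Reasoning.Setoid setoid
    expand : A ≈ (𝟙 ⊕ M ⊗ ⊖ t) ⊗ (A ⊗ (𝟙 ⊕ M ⊗ t)) ⊕ M ^ 2 ⊗ (t ⊗ t ⊗ A)
    expand = solve 3 (λ a m t → a := (con 1ℤ :+ m :* :- t) :* (a :* (con 1ℤ :+ m :* t)) :+ m :* (m :* con 1ℤ) :* (t :* t :* a))
                     ≈-refl A M t

  1+M-⊗ : ∀ {A B a b} M → A ≡ 𝟙 ⊕ M ⊗ a [mod M ^ 2 ] → B ≡ 𝟙 ⊕ M ⊗ b [mod M ^ 2 ] →
          A ⊗ B ≡ 𝟙 ⊕ M ⊗ (a ⊕ b) [mod M ^ 2 ]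
  1+M-⊗ {a = a} {b} M A≡ B≡ = ≡-mod-trans (⊗-cong-mod A≡ B≡) (≡-mod (a ⊗ b)
    (solve 3 (λ m a b → (con 1ℤ :+ m :* a) :* (con 1ℤ :+ m :* b) := con 1ℤ :+ m :* (a :+ b) :+ m :* (m :* con 1ℤ) :* (a :* b))
           ≈-refl M a b))

module Lifting where

  open PowerSeries
  open Congruence
  open import Data.Nat.Base as ℕ using (ℕ; zero; suc)
  open import Data.Nat.Combinatorics using (_C_; nC1≡n; nCk+nC[k+1]≡[n+1]C[k+1])
  open import Data.Nat.Divisibility using (_∣_; quotient; m∣n⇒n≡quotient*m)
  open import Data.Integer.Base using (+_; 0ℤ; 1ℤ)
  open import Function.Base using (_$_)
  open import Relation.Binary.PropositionalEquality using (_≡_)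
  import Relation.Binary.PropositionalEquality as ≡
  import Data.Nat.Properties as ℕ

  binomial-mod-cube : ∀ a r →
    (𝟙 ⊕ a) ^ r ≡ 𝟙 ⊕ ι (+ r) ⊗ a ⊕ ι (+ (r C 2)) ⊗ a ⊗ a [mod a ⊗ a ⊗ a ]
  binomial-mod-cube a zero = ≈⇒≡-mod (solve 1 (λ a → con 1ℤ := con 1ℤ :+ con 0ℤ :* a :+ con 0ℤ :* a :* a) ≈-refl a)
  binomial-mod-cube a (suc r) =
    ≡-mod-trans (⊗-cong-mod (≡-mod-refl {A = 𝟙 ⊕ a}) (binomial-mod-cube a r))
      (≡-mod (ι (+ (r C 2))) $ ≈-trans
        (solve 3 (λ a r b → (con 1ℤ :+ a) :* (con 1ℤ :+ r :* a :+ b :* a :* a)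
                            := con 1ℤ :+ (con 1ℤ :+ r) :* a :+ (r :+ b) :* a :* a :+ a :* a :* a :* b)
               ≈-refl a (ι (+ r)) (ι (+ (r C 2))))
        (+-congʳ (+-cong (+-congˡ {𝟙} (*-congʳ (≈-sym (ι-+ 1 r))))
                         (*-congʳ (*-congʳ (≈-sym (≈-trans (ι-cong (≡.cong +_ pascal)) (ι-+ r (r C 2)))))))))
    where
    pascal : suc r C 2 ≡ r ℕ.+ r C 2
    pascal = ≡.trans (≡.sym (nCk+nC[k+1]≡[n+1]C[k+1] r 1)) (≡.cong (ℕ._+ r C 2) (nC1≡n r))

  binomial-mod-square : ∀ a r → (𝟙 ⊕ a) ^ r ≡ 𝟙 ⊕ ι (+ r) ⊗ a [mod a ⊗ a ]
  binomial-mod-square a r = ≡-mod-trans (≡-mod-weaken (a ⊗ a) a (binomial-mod-cube a r))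
    (≡-mod (ι (+ (r C 2))) (solve 3 (λ a r b → con 1ℤ :+ r :* a :+ b :* a :* a := con 1ℤ :+ r :* a :+ a :* a :* b)
                                    ≈-refl a (ι (+ r)) (ι (+ (r C 2)))))

  module Lift (p : ℕ) (p∣pC2 : p ∣ p C 2) where

    π : ℤ[[x]]
    π = ι (+ p)

    π^≈ : ∀ e → π ^ e ≈ ι (+ (p ℕ.^ e))
    π^≈ zero    = ≈-refl
    π^≈ (suc e) = ≈-trans (*-congˡ (π^≈ e)) (≈-sym (ι-ℕ* p (p ℕ.^ e)))

    -- (1 + p^{j+1}V)^p ≡ 1 + p^{j+2}V + C(p,2) p^{2j+2}V² (mod p^{3j+3}), and p ∣ C(p,2)
    -- pushes the last term into p^{j+3}.
    lift-exponent : ∀ j {A W} → A ≡ 𝟙 ⊕ π ^ suc j ⊗ W [mod π ^ suc (suc j) ] →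
                    A ^ p ≡ 𝟙 ⊕ π ^ suc (suc j) ⊗ W [mod π ^ suc (suc (suc j)) ]
    lift-exponent j {A} {W} (≡-mod Z A≈) =
      ≈-≡-mod-trans (^-congˡ p A≈1+a)
        (≡-mod-trans (≡-mod-weaken (π ^ suc (suc (suc j))) (πʲ ⊗ πʲ ⊗ V ⊗ V ⊗ V)
                        (≡-mod-resp-modulus a³≈ (binomial-mod-cube a p)))
          (≡-mod (Z ⊕ τ ⊗ πʲ ⊗ V ⊗ V) (≈-trans (+-congˡ {𝟙 ⊕ π ⊗ a} (*-congʳ (*-congʳ pC2≈τπ))) collect)))
      where
      πʲ V a τ : ℤ[[x]]
      πʲ = π ^ j
      V  = W ⊕ π ⊗ Z
      a  = π ⊗ πʲ ⊗ V
      τ  = ι (+ quotient p∣pC2)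
      A≈1+a : A ≈ 𝟙 ⊕ a
      A≈1+a = ≈-trans A≈ (solve 4 (λ π πʲ w z → con 1ℤ :+ π :* πʲ :* w :+ π :* (π :* πʲ) :* z
                                             := con 1ℤ :+ π :* πʲ :* (w :+ π :* z))
                                 ≈-refl π πʲ W Z)
      a³≈ : a ⊗ a ⊗ a ≈ π ^ suc (suc (suc j)) ⊗ (πʲ ⊗ πʲ ⊗ V ⊗ V ⊗ V)
      a³≈ = solve 3 (λ π πʲ v → π :* πʲ :* v :* (π :* πʲ :* v) :* (π :* πʲ :* v)
                              := π :* (π :* (π :* πʲ)) :* (πʲ :* πʲ :* v :* v :* v))
                    ≈-refl π πʲ V
      pC2≈τπ : ι (+ (p C 2)) ≈ τ ⊗ π
      pC2≈τπ = ≈-trans (ι-cong (≡.cong +_ (m∣n⇒n≡quotient*m p∣pC2))) (ι-ℕ* (quotient p∣pC2) p)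
      collect : 𝟙 ⊕ π ⊗ a ⊕ τ ⊗ π ⊗ a ⊗ a ≈ 𝟙 ⊕ π ^ suc (suc j) ⊗ W ⊕ π ^ suc (suc (suc j)) ⊗ (Z ⊕ τ ⊗ πʲ ⊗ V ⊗ V)
      collect = solve 5 (λ π πʲ w z τ →
                  con 1ℤ :+ π :* (π :* πʲ :* (w :+ π :* z)) :+ τ :* π :* (π :* πʲ :* (w :+ π :* z)) :* (π :* πʲ :* (w :+ π :* z))
                  := con 1ℤ :+ π :* (π :* πʲ) :* w :+ π :* (π :* (π :* πʲ)) :* (z :+ τ :* πʲ :* (w :+ π :* z) :* (w :+ π :* z)))
                  ≈-refl π πʲ W Z τ

    lift-exponent-iterated : ∀ {A W} → A ≡ 𝟙 ⊕ π ⊗ W [mod π ^ 2 ] →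
                             ∀ e → A ^ (p ℕ.^ e) ≡ 𝟙 ⊕ π ^ suc e ⊗ W [mod π ^ suc (suc e) ]
    lift-exponent-iterated {A} {W} A≡ zero =
      ≈-≡-mod-trans (⊗𝟙 A) (≡-mod-≈-trans A≡ (+-congˡ {𝟙} (*-congʳ (≈-sym (⊗𝟙 π)))))
    lift-exponent-iterated {A} {W} A≡ (suc e) =
      ≈-≡-mod-trans A^pp^e≈ (lift-exponent e (lift-exponent-iterated A≡ e))
      where
      A^pp^e≈ : A ^ (p ℕ.^ suc e) ≈ (A ^ (p ℕ.^ e)) ^ p
      A^pp^e≈ = ≈-trans (^-congʳ A (ℕ.*-comm p (p ℕ.^ e))) (≈-sym (^-assocʳ A (p ℕ.^ e) p))

    pow-congruence : ∀ {A K} → A ≡ 𝟙 ⊕ π ⊗ K [mod π ^ 2 ] → ∀ k m →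
                     A ^ (p ℕ.^ k ℕ.* m) ≡ 𝟙 ⊕ ι (+ m) ⊗ π ^ suc k ⊗ K [mod π ^ suc (suc k) ]
    pow-congruence {A} {K} A≡ k m =
      ≈-≡-mod-trans (≈-sym (^-assocʳ A (p ℕ.^ k) m))
        (≡-mod-trans (^-cong-mod m (lift-exponent-iterated A≡ k))
          (≡-mod-≈-trans (≡-mod-weaken (π ^ suc (suc k)) (π ^ k ⊗ K ⊗ K) (≡-mod-resp-modulus a²≈ (binomial-mod-square a m)))
            (+-congˡ {𝟙} (≈-sym (⊗-assoc (ι (+ m)) (π ^ suc k) K)))))
      where
      a : ℤ[[x]]
      a = π ^ suc k ⊗ K
      a²≈ : a ⊗ a ≈ π ^ suc (suc k) ⊗ (π ^ k ⊗ K ⊗ K)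
      a²≈ = solve 3 (λ π πᵏ k → π :* πᵏ :* k :* (π :* πᵏ :* k) := π :* (π :* πᵏ) :* (πᵏ :* k :* k)) ≈-refl π (π ^ k) K

module Monomials where

  open PowerSeries
  open Congruence
  open import Data.Nat.Base as ℕ using (ℕ; zero; suc; _<_; _≤_; s≤s; NonZero)
  import Data.Nat.Properties as ℕ
  open import Data.Nat.DivMod using (_%_; m<n⇒m%n≡m; [m+n]%n≡m%n)
  open import Data.Integer.Base using (0ℤ; 1ℤ; -_; _+_; _-_)
  import Data.Integer.Properties as ℤ
  open import Data.Empty using (⊥-elim)
  open import Relation.Nullary.Decidable using (yes; no)
  open import Relation.Binary.PropositionalEquality using (_≡_; _≢_; refl; cong; sym; trans; subst)
  import Relation.Binary.PropositionalEquality
  open import Relation.Binary.Definitions using (tri<; tri≈; tri>)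

  X : ℤ[[x]]
  X 1 = 1ℤ
  X _ = 0ℤ

  X⊗-coeff-suc : ∀ f n → (X ⊗ f) (suc n) ≡ f n
  X⊗-coeff-suc f n = trans (ℤ.+-identityˡ _) (trans (coeff (⊗-cong tail-X≈𝟙 (≈-refl {f})) n) (coeff (𝟙⊗ f) n))
    where tail-X≈𝟙 : tail X ≈ 𝟙
          tail-X≈𝟙 = coeffwise λ { zero → refl ; (suc n) → refl }

  X^⊗-coeff-< : ∀ k f n → n < k → (X ^ k ⊗ f) n ≡ 0ℤ
  X^⊗-coeff-< (suc k) f zero    _         = coeff (⊗-assoc X (X ^ k) f) 0
  X^⊗-coeff-< (suc k) f (suc n) (s≤s n<k) =
    trans (coeff (⊗-assoc X (X ^ k) f) (suc n)) (trans (X⊗-coeff-suc _ n) (X^⊗-coeff-< k f n n<k))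

  X^⊗-coeff-+ : ∀ k f n → (X ^ k ⊗ f) (k ℕ.+ n) ≡ f n
  X^⊗-coeff-+ zero    f n = coeff (𝟙⊗ f) n
  X^⊗-coeff-+ (suc k) f n =
    trans (coeff (⊗-assoc X (X ^ k) f) (suc (k ℕ.+ n))) (trans (X⊗-coeff-suc _ (k ℕ.+ n)) (X^⊗-coeff-+ k f n))

  X^-coeff-≡ : ∀ k → (X ^ k) k ≡ 1ℤ
  X^-coeff-≡ k = trans (sym (coeff (⊗𝟙 (X ^ k)) k))
                       (subst (λ i → (X ^ k ⊗ 𝟙) i ≡ 1ℤ) (ℕ.+-identityʳ k) (X^⊗-coeff-+ k 𝟙 0))

  X^-coeff-≢ : ∀ k n → n ≢ k → (X ^ k) n ≡ 0ℤ
  X^-coeff-≢ k n n≢k with ℕ.<-cmp n k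
  ... | tri< n<k _ _ = trans (sym (coeff (⊗𝟙 (X ^ k)) n)) (X^⊗-coeff-< k 𝟙 n n<k)
  ... | tri≈ _ n≡k _ = ⊥-elim (n≢k n≡k)
  ... | tri> _ _ k<n = trans (sym (coeff (⊗𝟙 (X ^ k)) n))
                         (subst (λ i → (X ^ k ⊗ 𝟙) i ≡ 0ℤ) (ℕ.m+[n∸m]≡n (ℕ.<⇒≤ k<n)) (positive (n ℕ.∸ k) (ℕ.m<n⇒0<n∸m k<n)))
    where positive : ∀ i → 0 < i → (X ^ k ⊗ 𝟙) (k ℕ.+ i) ≡ 0ℤ
          positive (suc i) _ = X^⊗-coeff-+ k 𝟙 (suc i)

  ≡-mod-X^⇒coeff-≡ : ∀ {A B} N {n} → A ≡ B [mod X ^ N ] → n < N → A n ≡ B n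
  ≡-mod-X^⇒coeff-≡ {B = B} N {n} (≡-mod Q A≈) n<N =
    trans (coeff A≈ n) (trans (cong (λ v → B n + v) (X^⊗-coeff-< N Q n n<N)) (ℤ.+-identityʳ _))

  split-at : ∀ {P : ℕ → Set} N → (∀ n → n < N → P n) → (∀ m → P (N ℕ.+ m)) → ∀ n → P n
  split-at {P} N below above n with n ℕ.<? N
  ... | yes n<N = below n n<N
  ... | no  n≮N = subst P (ℕ.m+[n∸m]≡n (ℕ.≮⇒≥ n≮N)) (above (n ℕ.∸ N))

  infix 10 1-X^_

  1-X^_ : ℕ → ℤ[[x]]
  1-X^ k = 𝟙 ⊕ ⊖ X ^ k

  1-X^⊗≈ : ∀ k f → 1-X^ k ⊗ f ≈ f ⊕ ⊖ (X ^ k ⊗ f)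
  1-X^⊗≈ k f = solve 2 (λ x f → (con 1ℤ :- x) :* f := f :- x :* f) ≈-refl (X ^ k) f

  1-X^⊗-coeff-< : ∀ k f n → n < k → (1-X^ k ⊗ f) n ≡ f n
  1-X^⊗-coeff-< k f n n<k =
    trans (coeff (1-X^⊗≈ k f) n) (trans (cong (λ v → f n + - v) (X^⊗-coeff-< k f n n<k)) (ℤ.+-identityʳ (f n)))

  1-X^⊗-coeff-+ : ∀ k f n → (1-X^ k ⊗ f) (k ℕ.+ n) ≡ f (k ℕ.+ n) - f n
  1-X^⊗-coeff-+ k f n = trans (coeff (1-X^⊗≈ k f) (k ℕ.+ n)) (cong (λ v → f (k ℕ.+ n) - v) (X^⊗-coeff-+ k f n))

  periodic : (N : ℕ) .{{_ : NonZero N}} → ℤ[[x]] → ℤ[[x]]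
  periodic N f n = f (n % N)

  1-X^⊗periodic : ∀ N .{{_ : NonZero N}} f → (∀ n → N ≤ n → f n ≡ 0ℤ) → 1-X^ N ⊗ periodic N f ≈ f
  1-X^⊗periodic N f f≥N≡0 = coeffwise (split-at N below above)
    where
    below : ∀ n → n < N → (1-X^ N ⊗ periodic N f) n ≡ f n
    below n n<N = trans (1-X^⊗-coeff-< N _ n n<N) (cong f (m<n⇒m%n≡m n<N))
    above : ∀ m → (1-X^ N ⊗ periodic N f) (N ℕ.+ m) ≡ f (N ℕ.+ m)
    above m = begin
      (1-X^ N ⊗ periodic N f) (N ℕ.+ m)   ≡⟨ 1-X^⊗-coeff-+ N _ m ⟩
      f ((N ℕ.+ m) % N) - f (m % N)       ≡⟨ cong (λ i → f i - f (m % N)) N+m%N≡m%N ⟩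
      f (m % N) - f (m % N)               ≡⟨ ℤ.+-inverseʳ (f (m % N)) ⟩
      0ℤ                                  ≡⟨ sym (f≥N≡0 (N ℕ.+ m) (ℕ.m≤m+n N m)) ⟩
      f (N ℕ.+ m)                         ∎
      where
      open Relation.Binary.PropositionalEquality.≡-Reasoning
      N+m%N≡m%N : (N ℕ.+ m) % N ≡ m % N
      N+m%N≡m%N = trans (cong (_% N) (ℕ.+-comm N m)) ([m+n]%n≡m%n m N)

  [1-X^_]⁻¹ : (k : ℕ) .{{_ : NonZero k}} → ℤ[[x]]
  [1-X^ k ]⁻¹ = periodic k 𝟙

  1-X^⊗[1-X^]⁻¹ : ∀ k .{{_ : NonZero k}} → 1-X^ k ⊗ [1-X^ k ]⁻¹ ≈ 𝟙
  1-X^⊗[1-X^]⁻¹ k = 1-X^⊗periodic k 𝟙 𝟙≥k≡0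
    where 𝟙≥k≡0 : ∀ n → k ≤ n → 𝟙 n ≡ 0ℤ
          𝟙≥k≡0 (suc n) _ = refl
          𝟙≥k≡0 zero k≤0 = ⊥-elim (ℕ.<⇒≱ (ℕ.>-nonZero⁻¹ k) k≤0)

module Dilation where

  open PowerSeries
  open Monomials
  open import Data.Nat.Base as ℕ using (ℕ; zero; suc; _<_; _≤_; NonZero)
  import Data.Nat.Properties as ℕ
  open import Data.Nat.DivMod using (_/_; m*n/n≡m; /-monoˡ-≤)
  open import Data.Nat.Divisibility using (_∣_; _∣?_; divides; quotient; n∣m*n; ∣m+n∣m⇒∣n; ∣-refl)
  open import Data.Nat.Combinatorics using (_C_; nCk+nC[k+1]≡[n+1]C[k+1])
  open import Data.Integer.Base using (ℤ; +_; 0ℤ; 1ℤ; -_; _+_; _-_; _*_)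
  import Data.Integer.Properties as ℤ
  open import Data.Integer.Tactic.RingSolver using (solve-∀)
  open import Data.Bool.Base using (if_then_else_)
  open import Data.Empty using (⊥-elim)
  open import Relation.Nullary.Decidable using (Dec; yes; no; does)
  open import Relation.Nullary.Negation using (¬_)
  open import Relation.Binary.PropositionalEquality using (_≡_; refl; cong; cong₂; sym; trans; subst)

  dilate : (k : ℕ) .{{_ : NonZero k}} → (ℕ → ℤ) → ℤ[[x]]
  dilate k c n = if does (k ∣? n) then c (n / k) else 0ℤ

  module _ (k : ℕ) .{{_ : NonZero k}} where

    dilate-* : ∀ c j → dilate k c (j ℕ.* k) ≡ c j
    dilate-* c j with k ∣? (j ℕ.* k)
    ... | yes _   = cong c (m*n/n≡m j k)
    ... | no  k∤n = ⊥-elim (k∤n (n∣m*n j))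

    dilate-∤ : ∀ c {n} → ¬ k ∣ n → dilate k c n ≡ 0ℤ
    dilate-∤ c {n} k∤n with k ∣? n
    ... | yes k∣n = ⊥-elim (k∤n k∣n)
    ... | no  _   = refl

    dilate-∣ : ∀ c {n} → (k∣n : k ∣ n) → dilate k c n ≡ c (quotient k∣n)
    dilate-∣ c (divides q refl) = dilate-* c q

    dilate-cong : ∀ {a b} → (∀ j → a j ≡ b j) → dilate k a ≈ dilate k b
    dilate-cong {a} {b} a≡b = coeffwise λ n → dilate-cong-at n
      where
      dilate-cong-at : ∀ n → dilate k a n ≡ dilate k b n
      dilate-cong-at n with k ∣? n
      ... | yes _ = a≡b (n / k)
      ... | no  _ = refl

    dilate-≥ : ∀ c b {n} → (∀ j → b ≤ j → c j ≡ 0ℤ) → b ℕ.* k ≤ n → dilate k c n ≡ 0ℤ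
    dilate-≥ c b {n} c≥b≡0 bk≤n with k ∣? n
    ... | yes _ = c≥b≡0 (n / k) (subst (_≤ n / k) (m*n/n≡m b k) (/-monoˡ-≤ k bk≤n))
    ... | no  _ = refl

    Δ : (ℕ → ℤ) → ℕ → ℤ
    Δ c zero    = c 0
    Δ c (suc j) = c (suc j) - c j

    1-X^⊗dilate : ∀ c → 1-X^ k ⊗ dilate k c ≈ dilate k (Δ c)
    1-X^⊗dilate c = coeffwise (split-at k below above)
      where
      below : ∀ n → n < k → (1-X^ k ⊗ dilate k c) n ≡ dilate k (Δ c) n
      below n n<k = trans (1-X^⊗-coeff-< k _ n n<k) (below-at-quotient (k ∣? n))
        where
        below-at-quotient : Dec (k ∣ n) → dilate k c n ≡ dilate k (Δ c) n
        below-at-quotient (yes (divides zero    refl)) = trans (dilate-* c 0) (sym (dilate-* (Δ c) 0))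
        below-at-quotient (yes (divides (suc q) refl)) = ⊥-elim (ℕ.<⇒≱ n<k (ℕ.m≤m+n k (q ℕ.* k)))
        below-at-quotient (no  k∤n)                     = trans (dilate-∤ c k∤n) (sym (dilate-∤ (Δ c) k∤n))
      above : ∀ m → (1-X^ k ⊗ dilate k c) (k ℕ.+ m) ≡ dilate k (Δ c) (k ℕ.+ m)
      above m = trans (1-X^⊗-coeff-+ k _ m) (above-at-quotient (k ∣? m))
        where
        above-at-quotient : Dec (k ∣ m) → dilate k c (k ℕ.+ m) - dilate k c m ≡ dilate k (Δ c) (k ℕ.+ m)
        above-at-quotient (yes (divides q refl)) =
          trans (cong₂ _-_ (dilate-* c (suc q)) (dilate-* c q)) (sym (dilate-* (Δ c) (suc q)))
        above-at-quotient (no k∤m) =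
          trans (cong₂ _-_ (dilate-∤ c k∤k+m) (dilate-∤ c k∤m)) (sym (dilate-∤ (Δ c) k∤k+m))
          where k∤k+m : ¬ k ∣ k ℕ.+ m
                k∤k+m k∣k+m = k∤m (∣m+n∣m⇒∣n k∣k+m ∣-refl)

    X^*-dilate : ∀ m → X ^ (m ℕ.* k) ≈ dilate k (X ^ m)
    X^*-dilate m = coeffwise λ n → at (k ∣? n)
      where
      at : ∀ {n} → Dec (k ∣ n) → (X ^ (m ℕ.* k)) n ≡ dilate k (X ^ m) n
      at (yes (divides j refl)) with j ℕ.≟ m
      ... | yes refl = trans (X^-coeff-≡ (j ℕ.* k)) (sym (trans (dilate-* (X ^ j) j) (X^-coeff-≡ j)))
      ... | no  j≢m  = trans (X^-coeff-≢ (m ℕ.* k) (j ℕ.* k) (λ jk≡mk → j≢m (ℕ.*-cancelʳ-≡ j m k jk≡mk)))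
                             (sym (trans (dilate-* (X ^ m) j) (X^-coeff-≢ m j j≢m)))
      at {n} (no k∤n) = trans (X^-coeff-≢ (m ℕ.* k) n (λ { refl → k∤n (n∣m*n m) })) (sym (dilate-∤ (X ^ m) k∤n))

  infix 8 −1^_

  −1^_ : ℕ → ℤ
  −1^ zero  = 1ℤ
  −1^ suc j = - −1^ j

  alternatingBinomial : ℕ → ℕ → ℤ
  alternatingBinomial r j = −1^ j * + (r C j)

  binomial-theorem : ∀ k .{{_ : NonZero k}} r → (1-X^ k) ^ r ≈ dilate k (alternatingBinomial r)
  binomial-theorem k zero    = coeffwise 𝟙≡dilate
    where
    𝟙≡dilate : ∀ n → 𝟙 n ≡ dilate k (alternatingBinomial 0) n
    𝟙≡dilate zero    = sym (dilate-* k (alternatingBinomial 0) 0)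
    𝟙≡dilate (suc n) = sym (vanishes (k ∣? suc n))
      where
      vanishes : Dec (k ∣ suc n) → dilate k (alternatingBinomial 0) (suc n) ≡ 0ℤ
      vanishes (yes k∣n@(divides (suc q) _)) = trans (dilate-∣ k (alternatingBinomial 0) k∣n) (ℤ.*-zeroʳ (−1^ suc q))
      vanishes (no  k∤n)                     = dilate-∤ k (alternatingBinomial 0) k∤n
  binomial-theorem k (suc r) =
    ≈-trans (*-congˡ (binomial-theorem k r)) (≈-trans (1-X^⊗dilate k (alternatingBinomial r)) (dilate-cong k pascal))
    where
    pascal : ∀ j → Δ k (alternatingBinomial r) j ≡ alternatingBinomial (suc r) j
    pascal zero    = refl
    pascal (suc j) = trans (factor (−1^ j) (+ (r C j)) (+ (r C suc j)))
                           (cong (λ b → - −1^ j * + b) (nCk+nC[k+1]≡[n+1]C[k+1] r j))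
      where factor : ∀ s a b → - s * b - s * a ≡ - s * (a + b)
            factor = solve-∀

module BinomialsModPrime where

  open Dilation using (−1^_; alternatingBinomial)
  open import Data.Nat.Base as ℕ using (ℕ; zero; suc; _<_; _≤_; z≤n; s≤s)
  import Data.Nat.Properties as ℕ
  open import Data.Nat.Tactic.RingSolver using () renaming (solve-∀ to ℕ-solve-∀)
  open import Data.Nat.Combinatorics using (_C_; nCn≡1; nC1≡n; k>n⇒nCk≡0; nCk+nC[k+1]≡[n+1]C[k+1])
  open import Data.Nat.Divisibility using (_∣_; divides; ∣⇒≤; _∣0; ∣m∣n⇒∣m+n)
  open import Data.Nat.DivMod using (_/_; m*[n/m]≡n; m<n⇒m/n≡0)
  open import Data.Nat.Primality using (Prime; euclidsLemma; prime⇒irreducible)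
  open import Data.Integer.Base using (ℤ; +_; 0ℤ; 1ℤ; -_; _+_; _-_; _*_)
  import Data.Integer.Properties as ℤ
  open import Data.Integer.Tactic.RingSolver using (solve-∀)
  open import Data.Product.Base using (∃-syntax; _,_)
  open import Data.Sum.Base using (inj₁; inj₂)
  open import Data.Empty using (⊥-elim)
  open import Relation.Nullary.Negation using (¬_)
  open import Relation.Binary.PropositionalEquality using (_≡_; refl; cong; cong₂; sym; trans)

  [1+k]*[1+n]C[1+k]≡[1+n]*nCk : ∀ n k → suc k ℕ.* (suc n C suc k) ≡ suc n ℕ.* (n C k)
  [1+k]*[1+n]C[1+k]≡[1+n]*nCk zero    zero    = refl
  [1+k]*[1+n]C[1+k]≡[1+n]*nCk zero    (suc k) = ℕ.*-zeroʳ (suc (suc k))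
  [1+k]*[1+n]C[1+k]≡[1+n]*nCk (suc n) zero    = trans (ℕ.*-identityˡ _) (trans (nC1≡n (suc (suc n))) (sym (ℕ.*-identityʳ _)))
  [1+k]*[1+n]C[1+k]≡[1+n]*nCk (suc n) (suc k) = begin
    suc (suc k) ℕ.* (suc (suc n) C suc (suc k))
      ≡⟨ cong (suc (suc k) ℕ.*_) (sym (nCk+nC[k+1]≡[n+1]C[k+1] (suc n) (suc k))) ⟩
    suc (suc k) ℕ.* (a ℕ.+ b)
      ≡⟨ expand (suc k) a b ⟩
    suc k ℕ.* a ℕ.+ suc (suc k) ℕ.* b ℕ.+ a
      ≡⟨ cong₂ (λ x y → x ℕ.+ y ℕ.+ a) ([1+k]*[1+n]C[1+k]≡[1+n]*nCk n k) ([1+k]*[1+n]C[1+k]≡[1+n]*nCk n (suc k)) ⟩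
    suc n ℕ.* (n C k) ℕ.+ suc n ℕ.* (n C suc k) ℕ.+ a
      ≡⟨ cong (ℕ._+ a) (sym (ℕ.*-distribˡ-+ (suc n) (n C k) (n C suc k))) ⟩
    suc n ℕ.* (n C k ℕ.+ n C suc k) ℕ.+ a
      ≡⟨ cong (λ x → suc n ℕ.* x ℕ.+ a) (nCk+nC[k+1]≡[n+1]C[k+1] n k) ⟩
    suc n ℕ.* a ℕ.+ a
      ≡⟨ ℕ.+-comm (suc n ℕ.* a) a ⟩
    suc (suc n) ℕ.* a ∎
    where
    open Relation.Binary.PropositionalEquality.≡-Reasoning
    a b : ℕ
    a = suc n C suc k
    b = suc n C suc (suc k)
    expand : ∀ k a b → suc k ℕ.* (a ℕ.+ b) ≡ k ℕ.* a ℕ.+ suc k ℕ.* b ℕ.+ a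
    expand = ℕ-solve-∀

  −1^-odd : ∀ n → ¬ 2 ∣ n → −1^ n ≡ - 1ℤ
  −1^-odd zero          2∤n = ⊥-elim (2∤n (2 ∣0))
  −1^-odd (suc zero)    _   = refl
  −1^-odd (suc (suc n)) 2∤n = trans (ℤ.neg-involutive (−1^ n)) (−1^-odd n (λ 2∣n → 2∤n (∣m∣n⇒∣m+n (divides 1 refl) 2∣n)))

  −1^-square : ∀ i → −1^ i * −1^ i ≡ 1ℤ
  −1^-square zero    = refl
  −1^-square (suc i) = trans (neg*neg (−1^ i)) (−1^-square i)
    where neg*neg : ∀ a → - a * - a ≡ a * a
          neg*neg = solve-∀

  module ModPrime (p-1 : ℕ) (p-prime : Prime (suc p-1)) (3≤p : 3 ≤ suc p-1) where

    p : ℕ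
    p = suc p-1

    1<p : 1 < p
    1<p = ℕ.<-≤-trans (s≤s (s≤s z≤n)) 3≤p

    p∤ : ∀ {j} → 0 < j → j < p → ¬ p ∣ j
    p∤ 0<j j<p p∣j = ℕ.<⇒≱ j<p (∣⇒≤ {{ℕ.>-nonZero 0<j}} p∣j)

    p∣pC : ∀ j → 0 < j → j < p → p ∣ p C j
    p∣pC (suc i) _ i<p with euclidsLemma (suc i) (p C suc i) p-prime
                                (divides (p-1 C i) (trans ([1+k]*[1+n]C[1+k]≡[1+n]*nCk p-1 i) (ℕ.*-comm p (p-1 C i))))
    ... | inj₁ p∣j = ⊥-elim (p∤ (s≤s z≤n) i<p p∣j)
    ... | inj₂ p∣C = p∣C

    [p-1]C≡−1^ : ∀ i → i < p → ∃[ w ] + (p-1 C i) ≡ −1^ i + + p * w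
    [p-1]C≡−1^ zero    _   = 0ℤ , sym (cong (λ v → 1ℤ + v) (ℤ.*-zeroʳ (+ p)))
    [p-1]C≡−1^ (suc i) i<p with [p-1]C≡−1^ i (ℕ.<-trans (ℕ.n<1+n i) i<p) | p∣pC (suc i) (s≤s z≤n) i<p
    ... | w , C≡ | divides q pC≡ = + q - w , (begin
      + (p-1 C suc i)                          ≡⟨ add-sub (+ (p-1 C i)) (+ (p-1 C suc i)) ⟩
      (+ (p-1 C i) + + (p-1 C suc i)) - + (p-1 C i) ≡⟨ cong₂ _-_ (cong +_ (trans (nCk+nC[k+1]≡[n+1]C[k+1] p-1 i) pC≡)) C≡ ⟩
      + (q ℕ.* p) - (−1^ i + + p * w)          ≡⟨ cong (_- (−1^ i + + p * w)) (ℤ.pos-* q p) ⟩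
      + q * + p - (−1^ i + + p * w)            ≡⟨ regroup (+ q) (+ p) (−1^ i) w ⟩
      - −1^ i + + p * (+ q - w)                ∎)
      where
      open Relation.Binary.PropositionalEquality.≡-Reasoning
      add-sub : ∀ a b → b ≡ (a + b) - a
      add-sub = solve-∀
      regroup : ∀ q p s w → q * p - (s + p * w) ≡ - s + p * (q - w)
      regroup = solve-∀

    c : ℕ → ℤ
    c j = −1^ j * + ((p C j) / p)

    p*c≡alternatingBinomial : ∀ j → 0 < j → j < p → + p * c j ≡ alternatingBinomial p j
    p*c≡alternatingBinomial j 0<j j<p =
      trans (swap (+ p) (−1^ j) (+ ((p C j) / p)))
            (cong (λ v → −1^ j * v) (trans (sym (ℤ.pos-* p ((p C j) / p))) (cong +_ (m*[n/m]≡n {p} {p C j} (p∣pC j 0<j j<p)))))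
      where swap : ∀ a b c → a * (b * c) ≡ b * (a * c)
            swap = solve-∀

    c-≥ : ∀ j → p ≤ j → c j ≡ 0ℤ
    c-≥ j p≤j with ℕ.m≤n⇒m<n∨m≡n p≤j
    ... | inj₁ p<j  = trans (cong (λ v → −1^ j * + (v / p)) (k>n⇒nCk≡0 p<j)) (ℤ.*-zeroʳ (−1^ j))
    ... | inj₂ refl = trans (cong (λ v → −1^ p * + (v / p)) (nCn≡1 p))
                            (trans (cong (λ v → −1^ p * + v) (m<n⇒m/n≡0 1<p)) (ℤ.*-zeroʳ (−1^ p)))

    c-0 : c 0 ≡ 0ℤ
    c-0 = cong (λ v → 1ℤ * + v) (m<n⇒m/n≡0 1<p)

    c-inverse : ∀ j → 0 < j → j < p → ∃[ w ] + j * - c j ≡ 1ℤ + + p * w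
    c-inverse (suc i) 0<j j<p with [p-1]C≡−1^ i (ℕ.<-trans (ℕ.n<1+n i) j<p)
    ... | w , C≡ = −1^ i * w , (begin
      + suc i * - c (suc i)           ≡⟨ unfold (+ suc i) (−1^ i) (+ q) ⟩
      −1^ i * (+ suc i * + q)         ≡⟨ cong (λ v → −1^ i * v) (trans (sym (ℤ.pos-* (suc i) q)) (cong +_ jq≡C)) ⟩
      −1^ i * + (p-1 C i)             ≡⟨ cong (λ v → −1^ i * v) C≡ ⟩
      −1^ i * (−1^ i + + p * w)       ≡⟨ ℤ.*-distribˡ-+ (−1^ i) (−1^ i) (+ p * w) ⟩
      −1^ i * −1^ i + −1^ i * (+ p * w) ≡⟨ cong₂ _+_ (−1^-square i) (swap (−1^ i) (+ p) w) ⟩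
      1ℤ + + p * (−1^ i * w)          ∎)
      where
      open Relation.Binary.PropositionalEquality.≡-Reasoning
      q = (p C suc i) / p
      jq≡C : suc i ℕ.* q ≡ p-1 C i
      jq≡C = ℕ.*-cancelˡ-≡ (suc i ℕ.* q) (p-1 C i) p (begin
        p ℕ.* (suc i ℕ.* q)   ≡⟨ ℕ.*-comm p (suc i ℕ.* q) ⟩
        suc i ℕ.* q ℕ.* p     ≡⟨ ℕ.*-assoc (suc i) q p ⟩
        suc i ℕ.* (q ℕ.* p)   ≡⟨ cong (suc i ℕ.*_) (ℕ.*-comm q p) ⟩
        suc i ℕ.* (p ℕ.* q)   ≡⟨ cong (suc i ℕ.*_) (m*[n/m]≡n {p} {p C suc i} (p∣pC (suc i) 0<j j<p)) ⟩
        suc i ℕ.* (p C suc i) ≡⟨ [1+k]*[1+n]C[1+k]≡[1+n]*nCk p-1 i ⟩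
        p ℕ.* (p-1 C i)       ∎)
      unfold : ∀ j s q → j * - (- s * q) ≡ s * (j * q)
      unfold = solve-∀
      swap : ∀ a b c → a * (b * c) ≡ b * (a * c)
      swap = solve-∀

    −c≡inverse : ∀ {ns u} → 1 ≤ ns → ns < p → 1 ≤ u → p ∣ u ℕ.* ns ℕ.∸ 1 → ∃[ y ] - c ns ≡ + u + + p * y
    −c≡inverse {ns} {u} 1≤ns ns<p 1≤u p∣uns-1 with c-inverse ns 1≤ns ns<p | p∣uns-1
    ... | w , ns*a≡ | divides v uns-1≡ = + u * w - a * + v , (begin
      a                                              ≡⟨ expand a (+ u) (+ ns) ⟩
      + u + + u * (+ ns * a - 1ℤ) - a * (+ u * + ns - 1ℤ) ≡⟨ cong₂ (λ x y → + u + + u * (x - 1ℤ) - a * (y - 1ℤ)) ns*a≡ u*ns≡ ⟩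
      + u + + u * (1ℤ + + p * w - 1ℤ) - a * (1ℤ + + v * + p - 1ℤ) ≡⟨ collect a (+ u) (+ p) w (+ v) ⟩
      + u + + p * (+ u * w - a * + v)                ∎)
      where
      open Relation.Binary.PropositionalEquality.≡-Reasoning
      a = - c ns
      u*ns≡ : + u * + ns ≡ 1ℤ + + v * + p
      u*ns≡ = trans (sym (ℤ.pos-* u ns)) (trans (cong +_ (trans (sym (ℕ.m+[n∸m]≡n (ℕ.*-mono-≤ 1≤u 1≤ns))) (cong (1 ℕ.+_) uns-1≡)))
                (cong (λ x → 1ℤ + x) (ℤ.pos-* v p)))
      expand : ∀ a u n → a ≡ u + u * (n * a - 1ℤ) - a * (u * n - 1ℤ)
      expand = solve-∀
      collect : ∀ a u p w v → u + u * (1ℤ + p * w - 1ℤ) - a * (1ℤ + v * p - 1ℤ) ≡ u + p * (u * w - a * v)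
      collect = solve-∀

    −1^p : −1^ p ≡ - 1ℤ
    −1^p = −1^-odd p 2∤p
      where 2∤p : ¬ 2 ∣ p
            2∤p 2∣p with prime⇒irreducible p-prime 2∣p
            ... | inj₁ ()
            ... | inj₂ refl = ℕ.<⇒≱ (s≤s (s≤s (s≤s z≤n))) 3≤p

    p∣pC2 : p ∣ p C 2
    p∣pC2 = p∣pC 2 (s≤s z≤n) 3≤p

module LocalFactors (p-1 : ℕ) (p-prime : Prime (suc p-1)) (3≤p : 3 ≤ suc p-1) where

  open PowerSeries
  open Monomials
  open Dilation
  open BinomialsModPrime.ModPrime p-1 p-prime 3≤p
  open Lifting.Lift p p∣pC2 using (π)
  open Congruence using (_≡_[mod_]; 1+M-inverse)
  open import Data.Nat.Base as ℕ using (ℕ; zero; suc; z≤n; s≤s; NonZero)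
  import Data.Nat.Properties as ℕ
  open import Data.Nat.Combinatorics using (k>n⇒nCk≡0; nCn≡1)
  open import Data.Nat.Divisibility using (_∣?_)
  open import Data.Nat.DivMod using (_/_)
  open import Data.Integer.Base using (+_; 0ℤ; 1ℤ; -_; _+_; _-_; _*_)
  import Data.Integer.Properties as ℤ
  open import Relation.Nullary.Decidable using (yes; no)
  open import Relation.Binary.PropositionalEquality using (_≡_; refl; cong; sym)
  open import Relation.Binary.Definitions using (tri<; tri≈; tri>)

  alternatingBinomial-p : ∀ j → alternatingBinomial p j ≡ alternatingBinomial 0 j - (X ^ p) j + + p * c j
  alternatingBinomial-p zero rewrite X^-coeff-≢ p 0 (λ ()) | c-0 | ℤ.*-zeroʳ (+ p) = refl
  alternatingBinomial-p j@(suc _) with ℕ.<-cmp j p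
  ... | tri< j<p j≢p _
    rewrite X^-coeff-≢ p j j≢p | ℤ.*-zeroʳ (−1^ j) | p*c≡alternatingBinomial j (s≤s z≤n) j<p
    = sym (ℤ.+-identityˡ _)
  ... | tri≈ _ refl _
    rewrite X^-coeff-≡ p | c-≥ p ℕ.≤-refl | nCn≡1 p | ℤ.*-identityʳ (−1^ p) | ℤ.*-zeroʳ (−1^ p) | ℤ.*-zeroʳ (+ p)
    = −1^p
  ... | tri> _ j≢p p<j
    rewrite X^-coeff-≢ p j j≢p | c-≥ j (ℕ.<⇒≤ p<j) | k>n⇒nCk≡0 p<j | ℤ.*-zeroʳ (−1^ j) | ℤ.*-zeroʳ (+ p)
    = refl

  module _ (k : ℕ) .{{_ : NonZero k}} where

    instance
      pk≢0 : NonZero (p ℕ.* k)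
      pk≢0 = ℕ.m*n≢0 p k

    D : ℤ[[x]]
    D = dilate k c

    T : ℤ[[x]]
    T = periodic (p ℕ.* k) D

    Φ : ℤ[[x]]
    Φ = 1-X^ (p ℕ.* k) ⊗ [1-X^ k ]⁻¹ ^ p

    [1-X^k]^p≈1-X^pk+πD : (1-X^ k) ^ p ≈ 1-X^ (p ℕ.* k) ⊕ π ⊗ D
    [1-X^k]^p≈1-X^pk+πD = ≈-trans (binomial-theorem k p) (≈-trans (coeffwise at) (≈-sym
      (+-cong (+-cong (binomial-theorem k 0) (-‿cong (X^*-dilate k p))) (≈-refl {π ⊗ D}))))
      where
      at : ∀ n → dilate k (alternatingBinomial p) n
               ≡ (dilate k (alternatingBinomial 0) ⊕ ⊖ dilate k (X ^ p) ⊕ π ⊗ D) n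
      at n rewrite ι⊗-coeff (+ p) D n with k ∣? n
      ... | yes _ = alternatingBinomial-p (n / k)
      ... | no  _ = sym (cong (λ v → 0ℤ - 0ℤ + v) (ℤ.*-zeroʳ (+ p)))

    1-X^⊗T≈D : 1-X^ (p ℕ.* k) ⊗ T ≈ D
    1-X^⊗T≈D = 1-X^⊗periodic (p ℕ.* k) D (λ n pk≤n → dilate-≥ k c p c-≥ pk≤n)

    Φ⊗[1+πT]≈𝟙 : Φ ⊗ (𝟙 ⊕ π ⊗ T) ≈ 𝟙
    Φ⊗[1+πT]≈𝟙 = begin
      Φ ⊗ (𝟙 ⊕ π ⊗ T)                               ≈⟨ regroup ⟩
      G ^ p ⊗ (1-X^ (p ℕ.* k) ⊕ π ⊗ (1-X^ (p ℕ.* k) ⊗ T)) ≈⟨ *-congˡ (+-congˡ {1-X^ (p ℕ.* k)} (*-congˡ 1-X^⊗T≈D)) ⟩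
      G ^ p ⊗ (1-X^ (p ℕ.* k) ⊕ π ⊗ D)                ≈⟨ *-congˡ (≈-sym [1-X^k]^p≈1-X^pk+πD) ⟩
      G ^ p ⊗ (1-X^ k) ^ p                            ≈⟨ ≈-sym (^-distrib-* G (1-X^ k) p) ⟩
      (G ⊗ 1-X^ k) ^ p                                ≈⟨ ^-congˡ p (≈-trans (⊗-comm G (1-X^ k)) (1-X^⊗[1-X^]⁻¹ k)) ⟩
      𝟙 ^ p                                          ≈⟨ 𝟙^ p ⟩
      𝟙                                              ∎
      where
      open import Relation.Binary.Reasoning.Setoid setoid
      G = [1-X^ k ]⁻¹
      regroup : Φ ⊗ (𝟙 ⊕ π ⊗ T) ≈ G ^ p ⊗ (1-X^ (p ℕ.* k) ⊕ π ⊗ (1-X^ (p ℕ.* k) ⊗ T))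
      regroup = solve 4 (λ y g π t → y :* g :* (con 1ℤ :+ π :* t) := g :* (y :+ π :* (y :* t))) ≈-refl
                        (1-X^ (p ℕ.* k)) (G ^ p) π T

    Φ≡1-πT : Φ ≡ 𝟙 ⊕ π ⊗ ⊖ T [mod π ^ 2 ]
    Φ≡1-πT = 1+M-inverse π T Φ⊗[1+πT]≈𝟙

module GeneratingFunction (p-1 : ℕ) (p-prime : Prime (suc p-1)) (3≤p : 3 ≤ suc p-1) where

  open PowerSeries
  open Congruence
  open Monomials
  open BinomialsModPrime.ModPrime p-1 p-prime 3≤p using (p; 1<p; p∣pC2)
  open LocalFactors p-1 p-prime 3≤p
  open Lifting.Lift p p∣pC2 using (π)
  open import Defs using (Series; _·_; one; pow; geomInv; prodFactors; d)
  open import Data.Nat.Base as ℕ using (ℕ; zero; suc; _<_; z≤n; s≤s; NonZero)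
  import Data.Nat.Properties as ℕ
  open import Data.Nat.Divisibility using (_∣?_; n∣m⇒m%n≡0; m%n≡0⇒n∣m)
  open import Data.Nat.DivMod using (_%_)
  open import Data.Integer.Base using (+_; 1ℤ; _+_)
  import Data.Integer.Properties as ℤ
  open import Data.List.Properties using (map-applyUpTo)
  open import Data.Nat.ListAction using (sum)
  open import Data.Empty using (⊥-elim)
  open import Function.Base using (_∘_; id)
  open import Relation.Nullary.Decidable using (yes; no)
  open import Relation.Binary.PropositionalEquality using (_≡_; refl; cong; cong₂; sym; trans)

  embed : Series → ℤ[[x]]
  embed f n = + f n

  embed-· : ∀ f g → embed (f · g) ≈ embed f ⊗ embed g
  embed-· f g = coeffwise (at f)
    where
    ·-suc : ∀ f n → (f · g) (suc n) ≡ f 0 ℕ.* g (suc n) ℕ.+ ((f ∘ suc) · g) n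
    ·-suc f n = cong (f 0 ℕ.* g (suc n) ℕ.+_)
      (trans (cong sum (map-applyUpTo suc (λ i → f i ℕ.* g (suc n ℕ.∸ i)) (suc n)))
             (sym (cong sum (map-applyUpTo id (λ i → f (suc i) ℕ.* g (n ℕ.∸ i)) (suc n)))))
    at : ∀ f n → embed (f · g) n ≡ (embed f ⊗ embed g) n
    at f zero    = trans (cong +_ (ℕ.+-identityʳ _)) (ℤ.pos-* (f 0) (g 0))
    at f (suc n) = trans (cong +_ (·-suc f n))
                     (cong₂ _+_ (ℤ.pos-* (f 0) (g (suc n))) (at (f ∘ suc) n))

  embed-one : embed one ≈ 𝟙
  embed-one = coeffwise λ { zero → refl ; (suc n) → refl }

  embed-pow : ∀ r f → embed (pow r f) ≈ embed f ^ r
  embed-pow zero    f = embed-one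
  embed-pow (suc r) f = ≈-trans (embed-· f (pow r f)) (*-congˡ (embed-pow r f))

  embed-geomInv : ∀ k .{{_ : NonZero k}} → embed (geomInv k) ≈ [1-X^ k ]⁻¹
  embed-geomInv k = coeffwise at
    where
    at : ∀ n → embed (geomInv k) n ≡ [1-X^ k ]⁻¹ n
    at n with k ∣? n | n % k in n%k≡
    ... | yes k∣n | zero  = refl
    ... | yes k∣n | suc _ = ⊥-elim (ℕ.0≢1+n (trans (sym (n∣m⇒m%n≡0 n k k∣n)) n%k≡))
    ... | no  k∤n | zero  = ⊥-elim (k∤n (m%n≡0⇒n∣m n k n%k≡))
    ... | no  k∤n | suc _ = refl

  p^≢0 : ∀ i → NonZero (p ℕ.^ i)
  p^≢0 i = ℕ.m^n≢0 p i

  G Φᵢ Tᵢ : ℕ → ℤ[[x]]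
  G  i = [1-X^ p ℕ.^ i ]⁻¹ {{p^≢0 i}}
  Φᵢ i = Φ (p ℕ.^ i) {{p^≢0 i}}
  Tᵢ i = T (p ℕ.^ i) {{p^≢0 i}}

  H : ℕ → ℤ[[x]]
  H zero    = 𝟙
  H (suc N) = G N ^ p-1 ⊗ H N

  F : ℕ → ℤ[[x]]
  F N = [1-X^ 1 ]⁻¹ ⊗ H N

  embed-prodFactors : ∀ m N → embed (prodFactors p (p-1 ℕ.* m) N) ≈ H N ^ m
  embed-prodFactors m zero    = ≈-trans embed-one (≈-sym (𝟙^ m))
  embed-prodFactors m (suc N) = begin
    embed (pow (p-1 ℕ.* m) (geomInv (p ℕ.^ N)) · prodFactors p (p-1 ℕ.* m) N)
      ≈⟨ embed-· _ _ ⟩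
    embed (pow (p-1 ℕ.* m) (geomInv (p ℕ.^ N))) ⊗ embed (prodFactors p (p-1 ℕ.* m) N)
      ≈⟨ ⊗-cong (≈-trans (embed-pow (p-1 ℕ.* m) _) (^-congˡ (p-1 ℕ.* m) (embed-geomInv (p ℕ.^ N) {{p^≢0 N}}))) (embed-prodFactors m N) ⟩
    G N ^ (p-1 ℕ.* m) ⊗ H N ^ m
      ≈⟨ *-congʳ (≈-sym (^-assocʳ (G N) p-1 m)) ⟩
    (G N ^ p-1) ^ m ⊗ H N ^ m
      ≈⟨ ≈-sym (^-distrib-* (G N ^ p-1) (H N) m) ⟩
    H (suc N) ^ m ∎
    where open import Relation.Binary.Reasoning.Setoid setoid

  d≡F^m : ∀ m n → + d p m n ≡ (F (suc n) ^ m) n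
  d≡F^m m n = coeff (begin
    embed (pow m (geomInv 1) · prodFactors p (p-1 ℕ.* m) (suc n))
      ≈⟨ embed-· _ _ ⟩
    embed (pow m (geomInv 1)) ⊗ embed (prodFactors p (p-1 ℕ.* m) (suc n))
      ≈⟨ ⊗-cong (≈-trans (embed-pow m _) (^-congˡ m (embed-geomInv 1))) (embed-prodFactors m (suc n)) ⟩
    [1-X^ 1 ]⁻¹ ^ m ⊗ H (suc n) ^ m
      ≈⟨ ≈-sym (^-distrib-* [1-X^ 1 ]⁻¹ (H (suc n)) m) ⟩
    F (suc n) ^ m ∎) n
    where open import Relation.Binary.Reasoning.Setoid setoid

  Π : ℕ → ℤ[[x]]
  Π zero    = 𝟙
  Π (suc N) = Φᵢ N ⊗ Π N

  1-X^⊗F≈Π : ∀ N → 1-X^ (p ℕ.^ N) ⊗ F N ≈ Π N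
  1-X^⊗F≈Π zero    = ≈-trans (*-congˡ (⊗𝟙 [1-X^ 1 ]⁻¹)) (1-X^⊗[1-X^]⁻¹ 1)
  1-X^⊗F≈Π (suc N) = ≈-sym (begin
    Φᵢ N ⊗ Π N                              ≈⟨ *-congˡ (≈-sym (1-X^⊗F≈Π N)) ⟩
    (Y′ ⊗ (G N ⊗ G N ^ p-1)) ⊗ (Y ⊗ F N)   ≈⟨ regroup ⟩
    (Y ⊗ G N) ⊗ (Y′ ⊗ F (suc N))           ≈⟨ *-congʳ (1-X^⊗[1-X^]⁻¹ (p ℕ.^ N) {{p^≢0 N}}) ⟩
    𝟙 ⊗ (Y′ ⊗ F (suc N))                 ≈⟨ 𝟙⊗ _ ⟩
    Y′ ⊗ F (suc N)                        ∎)
    where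
    open import Relation.Binary.Reasoning.Setoid setoid
    Y Y′ : ℤ[[x]]
    Y  = 1-X^ (p ℕ.^ N)
    Y′ = 1-X^ (p ℕ.^ suc N)
    regroup : (Y′ ⊗ (G N ⊗ G N ^ p-1)) ⊗ (Y ⊗ F N) ≈ (Y ⊗ G N) ⊗ (Y′ ⊗ F (suc N))
    regroup = solve 6 (λ y′ g g′ y g₁ q → (y′ :* (g :* g′)) :* (y :* (g₁ :* q)) := (y :* g) :* (y′ :* (g₁ :* (g′ :* q))))
                      ≈-refl Y′ (G N) (G N ^ p-1) Y [1-X^ 1 ]⁻¹ (H N)

  F≡Π : ∀ N → F N ≡ Π N [mod X ^ (p ℕ.^ N) ]
  F≡Π N = ≡-mod (F N) (≈-trans split (+-congʳ (1-X^⊗F≈Π N)))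
    where split : F N ≈ 1-X^ (p ℕ.^ N) ⊗ F N ⊕ X ^ (p ℕ.^ N) ⊗ F N
          split = solve 2 (λ x f → f := (con 1ℤ :- x) :* f :+ x :* f) ≈-refl (X ^ (p ℕ.^ N)) (F N)

  n<p^n : ∀ n → n < p ℕ.^ n
  n<p^n zero    = s≤s z≤n
  n<p^n (suc n) = ℕ.≤-<-trans (n<p^n n) (ℕ.^-monoʳ-< p 1<p (ℕ.n<1+n n))

  d≡Π^m : ∀ m n → + d p m n ≡ (Π (suc n) ^ m) n
  d≡Π^m m n = trans (d≡F^m m n)
    (≡-mod-X^⇒coeff-≡ (p ℕ.^ suc n) (^-cong-mod m (F≡Π (suc n))) (ℕ.<-trans (n<p^n n) (ℕ.^-monoʳ-< p 1<p (ℕ.n<1+n n))))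

  K : ℕ → ℤ[[x]]
  K zero    = 𝟘
  K (suc N) = ⊖ Tᵢ N ⊕ K N

  Π≡1+πK : ∀ N → Π N ≡ 𝟙 ⊕ π ⊗ K N [mod π ^ 2 ]
  Π≡1+πK zero    = ≈⇒≡-mod (≈-sym (≈-trans (+-congˡ {𝟙} (zeroʳ π)) (+-identityʳ 𝟙)))
  Π≡1+πK (suc N) = 1+M-⊗ π (Φ≡1-πT (p ℕ.^ N) {{p^≢0 N}}) (Π≡1+πK N)

module LowestDigit (p-1 : ℕ) (p-prime : Prime (suc p-1)) (3≤p : 3 ≤ suc p-1) where

  open Dilation using (dilate; dilate-*; dilate-∤)
  open BinomialsModPrime.ModPrime p-1 p-prime 3≤p using (p; p∤; c; c-0)
  open GeneratingFunction p-1 p-prime 3≤p using (p^≢0; Tᵢ; K; n<p^n)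
  open import Data.Nat.Base as ℕ using (ℕ; zero; suc; _<_; _≤_; s≤s)
  import Data.Nat.Properties as ℕ
  open import Data.Nat.Divisibility using (_∣_; divides; n∣m⇒m%n≡0; m%n≡0⇒n∣m; ∣-trans; ∣m+n∣m⇒∣n; m∣m*n; *-cancelˡ-∣)
  open import Data.Nat.DivMod using (_%_; %-congˡ; [m+kn]%n≡m%n; m<n⇒m%n≡m; m∣n⇒o%n%m≡o%m)
  open import Data.Nat.Tactic.RingSolver using () renaming (solve-∀ to ℕ-solve-∀)
  open import Data.Integer.Base using (0ℤ; -_; _+_)
  import Data.Integer.Properties as ℤ
  open import Data.Empty using (⊥-elim)
  open import Relation.Nullary.Negation using (¬_)
  open import Relation.Binary.Definitions using (tri<; tri≈; tri>)
  open import Relation.Binary.PropositionalEquality using (_≡_; refl; cong; cong₂; sym; trans; subst)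
  import Relation.Binary.PropositionalEquality

  p^∣p^ : ∀ {i j} → i ≤ j → p ℕ.^ i ∣ p ℕ.^ j
  p^∣p^ {i} {j} i≤j = divides (p ℕ.^ (j ℕ.∸ i)) (begin
    p ℕ.^ j                          ≡⟨ cong (p ℕ.^_) (sym (ℕ.m+[n∸m]≡n i≤j)) ⟩
    p ℕ.^ (i ℕ.+ (j ℕ.∸ i))          ≡⟨ ℕ.^-distribˡ-+-* p i (j ℕ.∸ i) ⟩
    p ℕ.^ i ℕ.* p ℕ.^ (j ℕ.∸ i)      ≡⟨ ℕ.*-comm (p ℕ.^ i) _ ⟩
    p ℕ.^ (j ℕ.∸ i) ℕ.* p ℕ.^ i      ∎)
    where open Relation.Binary.PropositionalEquality.≡-Reasoning

  module _ {n s q ns : ℕ} (n≡ : n ≡ p ℕ.^ s ℕ.* (ns ℕ.+ p ℕ.* q)) (1≤ns : 1 ≤ ns) (ns<p : ns < p) where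

    p^s∣n : p ℕ.^ s ∣ n
    p^s∣n = divides (ns ℕ.+ p ℕ.* q) (trans n≡ (ℕ.*-comm (p ℕ.^ s) _))

    p^[1+s]∤n : ¬ p ℕ.^ suc s ∣ n
    p^[1+s]∤n p^[1+s]∣n = p∤ 1≤ns ns<p (∣m+n∣m⇒∣n (subst (p ∣_) (ℕ.+-comm ns (p ℕ.* q)) p∣ns+pq) (m∣m*n q))
      where
      p∣ns+pq : p ∣ ns ℕ.+ p ℕ.* q
      p∣ns+pq = *-cancelˡ-∣ (p ℕ.^ s) {{p^≢0 s}} (subst (λ x → p ℕ.^ s ℕ.* p ∣ x) n≡
                  (subst (_∣ n) (ℕ.*-comm p (p ℕ.^ s)) p^[1+s]∣n))

    Tᵢ-coeff-< : ∀ i → i < s → Tᵢ i n ≡ 0ℤ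
    Tᵢ-coeff-< i i<s = trans (cong (dilate (p ℕ.^ i) {{p^≢0 i}} c) n%p^[1+i]≡0) (trans (dilate-* (p ℕ.^ i) {{p^≢0 i}} c 0) c-0)
      where n%p^[1+i]≡0 : (n % p ℕ.^ suc i) {{p^≢0 (suc i)}} ≡ 0
            n%p^[1+i]≡0 = n∣m⇒m%n≡0 n (p ℕ.^ suc i) {{p^≢0 (suc i)}} (∣-trans (p^∣p^ i<s) p^s∣n)

    Tᵢ-coeff-≡ : Tᵢ s n ≡ c ns
    Tᵢ-coeff-≡ = trans (cong (dilate (p ℕ.^ s) {{p^≢0 s}} c) n%p^[1+s]≡) (dilate-* (p ℕ.^ s) {{p^≢0 s}} c ns)
      where
      n≡′ : n ≡ ns ℕ.* p ℕ.^ s ℕ.+ q ℕ.* p ℕ.^ suc s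
      n≡′ = trans n≡ (distribute (p ℕ.^ s) ns p q)
        where distribute : ∀ a b c d → a ℕ.* (b ℕ.+ c ℕ.* d) ≡ b ℕ.* a ℕ.+ d ℕ.* (c ℕ.* a)
              distribute = ℕ-solve-∀
      n%p^[1+s]≡ : (n % p ℕ.^ suc s) {{p^≢0 (suc s)}} ≡ ns ℕ.* p ℕ.^ s
      n%p^[1+s]≡ = trans (%-congˡ {{p^≢0 (suc s)}} n≡′) (trans ([m+kn]%n≡m%n (ns ℕ.* p ℕ.^ s) q (p ℕ.^ suc s) {{p^≢0 (suc s)}})
                     (m<n⇒m%n≡m {{p^≢0 (suc s)}} (ℕ.*-monoˡ-< (p ℕ.^ s) {{p^≢0 s}} ns<p)))

    Tᵢ-coeff-> : ∀ i → s < i → Tᵢ i n ≡ 0ℤ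
    Tᵢ-coeff-> i s<i = dilate-∤ (p ℕ.^ i) {{p^≢0 i}} c p^i∤r
      where
      instance
        _ = p^≢0 i
        _ = p^≢0 (suc i)
      p^i∤r : ¬ p ℕ.^ i ∣ n % p ℕ.^ suc i
      p^i∤r p^i∣r = p^[1+s]∤n (∣-trans (p^∣p^ s<i) (m%n≡0⇒n∣m n (p ℕ.^ i)
        (trans (sym (m∣n⇒o%n%m≡o%m (p ℕ.^ i) (p ℕ.^ suc i) n (p^∣p^ (ℕ.n≤1+n i)))) (n∣m⇒m%n≡0 _ (p ℕ.^ i) p^i∣r))))

    K-coeff : ∀ N → s < N → K N n ≡ - c ns
    K-coeff (suc N) s<1+N with ℕ.<-cmp s N
    ... | tri< s<N _ _ = trans (cong (λ v → - v + K N n) (Tᵢ-coeff-> N s<N)) (trans (ℤ.+-identityˡ (K N n)) (K-coeff N s<N))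
    ... | tri≈ _ refl _ = trans (cong₂ (λ a b → - a + b) Tᵢ-coeff-≡ (K-below s Tᵢ-coeff-<)) (ℤ.+-identityʳ (- c ns))
      where
      K-below : ∀ N → (∀ i → i < N → Tᵢ i n ≡ 0ℤ) → K N n ≡ 0ℤ
      K-below zero    _  = refl
      K-below (suc N) T≡0 = trans (cong₂ (λ a b → - a + b) (T≡0 N (ℕ.n<1+n N)) (K-below N (λ i i<N → T≡0 i (ℕ.m<n⇒m<1+n i<N)))) refl
    ... | tri> _ _ N<s = ⊥-elim (ℕ.<⇒≱ s<1+N N<s)

    s<1+n : s < suc n
    s<1+n = s≤s (ℕ.<⇒≤ (ℕ.<-≤-trans (n<p^n s) (subst (p ℕ.^ s ℕ.≤_) (sym n≡)
              (ℕ.m≤m*n (p ℕ.^ s) (ns ℕ.+ p ℕ.* q) {{ℕ.>-nonZero (ℕ.≤-trans 1≤ns (ℕ.m≤m+n ns (p ℕ.* q)))}}))))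

    K[1+n]-coeff : K (suc n) n ≡ - c ns
    K[1+n]-coeff = K-coeff (suc n) s<1+n

module PAdic where

  open import Data.Nat.Base as ℕ using (ℕ; zero; suc; _+_; _*_; _^_)
  import Data.Nat.Properties as ℕ
  open import Data.Nat.Divisibility using (_∣_; divides; 1∣_; ∣-trans; m∣m*n; *-monoʳ-∣; *-cancelˡ-∣)
  open import Data.Nat.Primality using (Prime; euclidsLemma; prime⇒nonZero)
  open import Data.Integer.Base using (ℤ; +_; ∣_∣; _-_) renaming (_*_ to _*ℤ_; _+_ to _+ℤ_)
  import Data.Integer.Properties as ℤ
  open import Data.Integer.Divisibility using () renaming (_∣_ to _∣ℤ_)
  open import Data.Integer.Tactic.RingSolver using (solve-∀)
  open import Data.Product.Base using (_×_; _,_; ∃-syntax)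
  open import Data.Sum.Base using (inj₁; inj₂)
  open import Data.Empty using (⊥-elim)
  open import Relation.Nullary.Negation using (¬_)
  open import Relation.Binary.PropositionalEquality using (_≡_; refl; cong; cong₂; sym; trans; subst; subst₂)
  import Relation.Binary.PropositionalEquality

  ∣ℤ-intro : ∀ a x w → x ≡ + a *ℤ w → + a ∣ℤ x
  ∣ℤ-intro a x w x≡aw = divides ∣ w ∣ (trans (cong ∣_∣ x≡aw) (trans (ℤ.abs-* (+ a) w) (ℕ.*-comm a ∣ w ∣)))

  module _ {p : ℕ} (p-prime : Prime p) where

    p^e∣m*u⇒p^e∣m : ∀ e m u → ¬ p ∣ u → p ^ e ∣ m * u → p ^ e ∣ m
    p^e∣m*u⇒p^e∣m zero    m u _   _ = 1∣ m
    p^e∣m*u⇒p^e∣m (suc e) m u p∤u p^[1+e]∣mu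
      with euclidsLemma m u p-prime (∣-trans (m∣m*n (p ^ e)) p^[1+e]∣mu)
    ... | inj₂ p∣u = ⊥-elim (p∤u p∣u)
    ... | inj₁ (divides m′ refl) = subst (p ^ suc e ∣_) (ℕ.*-comm p m′) (*-monoʳ-∣ p p^e∣m′)
      where
      instance _ = prime⇒nonZero p-prime
      p^e∣m′ : p ^ e ∣ m′
      p^e∣m′ = p^e∣m*u⇒p^e∣m e m′ u p∤u (*-cancelˡ-∣ p (subst (p * p ^ e ∣_) (reassoc m′ p u) p^[1+e]∣mu))
        where reassoc : ∀ a b c → a * b * c ≡ b * (a * c)
              reassoc a b c = trans (ℕ.*-assoc a b c) (trans (ℕ.*-comm a (b * c)) (trans (ℕ.*-assoc b c a) (cong (b *_) (ℕ.*-comm c a))))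

    module _ {k m u : ℕ} (p∤u : ¬ p ∣ u) (p^k∣m : p ^ k ∣ m) (p^[1+k]∤m : ¬ p ^ suc k ∣ m) where

      private
        p^[k+1]≡ : p ^ (k + 1) ≡ p * p ^ k
        p^[k+1]≡ = cong (p ^_) (ℕ.+-comm k 1)

        p^[k+2]≡ : p ^ (k + 2) ≡ p * p ^ (k + 1)
        p^[k+2]≡ = cong (p ^_) (trans (ℕ.+-comm k 2) (cong suc (ℕ.+-comm 1 k)))

        p^[k+1]∣pmu : p ^ (k + 1) ∣ p * m * u
        p^[k+1]∣pmu = subst (_∣ p * m * u) (sym p^[k+1]≡) (∣-trans (*-monoʳ-∣ p p^k∣m) (m∣m*n u))

      valuation-of-congruence : ∀ D → ∃[ w ] + D ≡ + (p * m * u) +ℤ + (p ^ (k + 2)) *ℤ w →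
        (+ (p ^ (k + 2)) ∣ℤ (+ D - + (p * m * u))) × (p ^ (k + 1) ∣ D) × ¬ (p ^ (k + 2) ∣ D)
      valuation-of-congruence D (w , D≡) = p^[k+2]∣D-pmu , p^[k+1]∣D , p^[k+2]∤D
        where
        P Q : ℤ
        P = + p
        Q = + (p ^ (k + 1))
        pmu : ℕ
        pmu = p * m * u
        P^[k+2]≡ : + (p ^ (k + 2)) ≡ P *ℤ Q
        P^[k+2]≡ = trans (cong +_ p^[k+2]≡) (ℤ.pos-* p (p ^ (k + 1)))

        p^[k+2]∣D-pmu : + (p ^ (k + 2)) ∣ℤ (+ D - + pmu)
        p^[k+2]∣D-pmu = ∣ℤ-intro (p ^ (k + 2)) _ w (trans (cong (_- + pmu) D≡) (add-sub (+ pmu) _))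
          where add-sub : ∀ a b → (a +ℤ b) - a ≡ b
                add-sub = solve-∀

        p^[k+1]∣D : p ^ (k + 1) ∣ D
        p^[k+1]∣D with p^[k+1]∣pmu
        ... | divides t pmu≡ = ∣ℤ-intro (p ^ (k + 1)) (+ D) (+ t +ℤ P *ℤ w) (begin
          + D                                   ≡⟨ D≡ ⟩
          + pmu +ℤ + (p ^ (k + 2)) *ℤ w          ≡⟨ cong₂ (λ a b → a +ℤ b *ℤ w) (trans (cong +_ pmu≡) (ℤ.pos-* t (p ^ (k + 1)))) P^[k+2]≡ ⟩
          + t *ℤ Q +ℤ P *ℤ Q *ℤ w                ≡⟨ factor (+ t) Q P w ⟩
          Q *ℤ (+ t +ℤ P *ℤ w)                   ∎)
          where
          open Relation.Binary.PropositionalEquality.≡-Reasoning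
          factor : ∀ t q p w → t *ℤ q +ℤ p *ℤ q *ℤ w ≡ q *ℤ (t +ℤ p *ℤ w)
          factor = solve-∀

        p^[k+2]∤D : ¬ (p ^ (k + 2) ∣ D)
        p^[k+2]∤D (divides c D≡c*) = p^[1+k]∤m (subst (λ e → p ^ e ∣ m) (ℕ.+-comm k 1)
          (p^e∣m*u⇒p^e∣m (k + 1) m u p∤u (*-cancelˡ-∣ p (subst₂ _∣_ p^[k+2]≡ (ℕ.*-assoc p m u) p^[k+2]∣pmu))))
          where
          instance _ = prime⇒nonZero p-prime
          p^[k+2]∣pmu : p ^ (k + 2) ∣ pmu
          p^[k+2]∣pmu = ∣ℤ-intro (p ^ (k + 2)) (+ pmu) (+ c - w) (begin
            + pmu                                  ≡⟨ isolate (+ pmu) (+ D) (+ (p ^ (k + 2)) *ℤ w) D≡ ⟩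
            + D - + (p ^ (k + 2)) *ℤ w             ≡⟨ cong (λ v → v - + (p ^ (k + 2)) *ℤ w) (trans (cong +_ D≡c*) (ℤ.pos-* c (p ^ (k + 2)))) ⟩
            + c *ℤ + (p ^ (k + 2)) - + (p ^ (k + 2)) *ℤ w ≡⟨ factor (+ c) (+ (p ^ (k + 2))) w ⟩
            + (p ^ (k + 2)) *ℤ (+ c - w)           ∎)
            where
            open Relation.Binary.PropositionalEquality.≡-Reasoning
            isolate : ∀ a d b → d ≡ a +ℤ b → a ≡ d - b
            isolate a d b refl = sub-add a b
              where sub-add : ∀ a b → a ≡ (a +ℤ b) - b
                    sub-add = solve-∀
            factor : ∀ c q w → c *ℤ q - q *ℤ w ≡ q *ℤ (c - w)
            factor = solve-∀

module CoefficientCongruence (p-1 : ℕ) (p-prime : Prime (suc p-1)) (3≤p : 3 ≤ suc p-1) where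

  open PowerSeries
  open Congruence
  open BinomialsModPrime.ModPrime p-1 p-prime 3≤p
  open Lifting.Lift p p∣pC2
  open GeneratingFunction p-1 p-prime 3≤p
  open LowestDigit p-1 p-prime 3≤p using (K[1+n]-coeff)
  open import Defs using (d)
  open import Data.Nat.Base as ℕ using (ℕ; suc; _<_)
  import Data.Nat.Properties as ℕ
  open import Data.Nat.Divisibility using (_∣_; divides; ∣1⇒≡1)
  open import Data.Integer.Base using (ℤ; +_; 0ℤ; 1ℤ; -_; _+_; _*_)
  import Data.Integer.Properties as ℤ
  open import Data.Integer.Tactic.RingSolver using (solve-∀)
  open import Data.Product.Base using (∃-syntax; _,_; proj₁; proj₂)
  open import Relation.Nullary.Negation using (¬_)
  open import Relation.Binary.PropositionalEquality using (_≡_; refl; cong; cong₂; sym; trans; subst)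
  import Relation.Binary.PropositionalEquality

  d[m,0]≡1 : ∀ m → d p m 0 ≡ 1
  d[m,0]≡1 m = ℤ.+-injective (trans (d≡F^m m 0) (^-coeff-0 m F[1]-coeff-0))
    where F[1]-coeff-0 : F 1 0 ≡ 1ℤ
          F[1]-coeff-0 = cong (λ v → 1ℤ * (v * 1ℤ)) (^-coeff-0 p-1 refl)

  p∤d[m,0] : ∀ m → ¬ p ∣ d p m 0
  p∤d[m,0] m p∣d = ℕ.<⇒≢ 1<p (sym (∣1⇒≡1 (subst (p ∣_) (d[m,0]≡1 m) p∣d)))

  d-congruence : ∀ {m} k → p ℕ.^ k ∣ m → ∀ n s q ns u → 1 ℕ.≤ n →
    n ≡ p ℕ.^ s ℕ.* (ns ℕ.+ p ℕ.* q) → 1 ℕ.≤ ns → ns < p → 1 ℕ.≤ u → p ∣ u ℕ.* ns ℕ.∸ 1 →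
    ∃[ w ] + d p m n ≡ + (p ℕ.* m ℕ.* u) + + (p ℕ.^ (k ℕ.+ 2)) * w
  d-congruence {m} k (divides m′ m≡m′p^k) n s q ns u 1≤n n≡ 1≤ns ns<p 1≤u p∣uns-1 = + m′ * y + z , (begin
    + d p m n                                                ≡⟨ d≡Π^m m n ⟩
    (Π (suc n) ^ m) n                                        ≡⟨ cong (λ r → (Π (suc n) ^ r) n) m≡ ⟩
    (Π (suc n) ^ (p ℕ.^ k ℕ.* m′)) n                          ≡⟨ proj₂ Π^-coeff ⟩
    (𝟙 ⊕ ι M ⊗ π ^ suc k ⊗ K (suc n)) n + + (p ℕ.^ suc (suc k)) * z
                                                             ≡⟨ cong₂ (λ a b → a + b * z) leading-coeff (ℤ.pos-* p (p ℕ.^ suc k)) ⟩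
    + (m′ ℕ.* p ℕ.^ suc k) * - c ns + P * + (p ℕ.^ suc k) * z ≡⟨ cong₂ (λ a b → a * b + P * + (p ℕ.^ suc k) * z) (ℤ.pos-* m′ _) (proj₂ −c≡u) ⟩
    M * + (p ℕ.^ suc k) * (U + P * y) + P * + (p ℕ.^ suc k) * z
                                                             ≡⟨ cong (λ v → M * v * (U + P * y) + P * v * z) (ℤ.pos-* p (p ℕ.^ k)) ⟩
    M * (P * Q) * (U + P * y) + P * (P * Q) * z              ≡⟨ collect M P Q U y z ⟩
    P * (Q * M) * U + P * (P * Q) * (M * y + z)              ≡⟨ cong₂ (λ a b → a + b * (M * y + z)) pmu≡ (sym p^[k+2]≡) ⟩
    + (p ℕ.* m ℕ.* u) + + (p ℕ.^ (k ℕ.+ 2)) * (M * y + z)   ∎)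
    where
    open Relation.Binary.PropositionalEquality.≡-Reasoning
    m≡ : m ≡ p ℕ.^ k ℕ.* m′
    m≡ = trans m≡m′p^k (ℕ.*-comm m′ (p ℕ.^ k))
    Π^-coeff : ∃[ z ] (Π (suc n) ^ (p ℕ.^ k ℕ.* m′)) n ≡ (𝟙 ⊕ ι (+ m′) ⊗ π ^ suc k ⊗ K (suc n)) n + + (p ℕ.^ suc (suc k)) * z
    Π^-coeff = ≡-mod-ι-coeff (+ (p ℕ.^ suc (suc k))) n
                 (≡-mod-resp-modulus (π^≈ (suc (suc k))) (pow-congruence (Π≡1+πK (suc n)) k m′))
    −c≡u : ∃[ y ] - c ns ≡ + u + + p * y
    −c≡u = −c≡inverse 1≤ns ns<p 1≤u p∣uns-1
    z y P Q M U : ℤ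
    z = proj₁ Π^-coeff
    y = proj₁ −c≡u
    P = + p
    Q = + (p ℕ.^ k)
    M = + m′
    U = + u
    leading-coeff : (𝟙 ⊕ ι M ⊗ π ^ suc k ⊗ K (suc n)) n ≡ + (m′ ℕ.* p ℕ.^ suc k) * - c ns
    leading-coeff = begin
      𝟙 n + (ι M ⊗ π ^ suc k ⊗ K (suc n)) n
        ≡⟨ cong₂ _+_ (𝟙-coeff-pos 1≤n) (coeff (*-congʳ (≈-trans (*-congˡ (π^≈ (suc k))) (≈-sym (ι-ℕ* m′ (p ℕ.^ suc k))))) n) ⟩
      0ℤ + (ι (+ (m′ ℕ.* p ℕ.^ suc k)) ⊗ K (suc n)) n    ≡⟨ ℤ.+-identityˡ _ ⟩
      (ι (+ (m′ ℕ.* p ℕ.^ suc k)) ⊗ K (suc n)) n         ≡⟨ ι⊗-coeff _ (K (suc n)) n ⟩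
      + (m′ ℕ.* p ℕ.^ suc k) * K (suc n) n              ≡⟨ cong (+ (m′ ℕ.* p ℕ.^ suc k) *_) (K[1+n]-coeff {n} {s} {q} {ns} n≡ 1≤ns ns<p) ⟩
      + (m′ ℕ.* p ℕ.^ suc k) * - c ns                   ∎
    collect : ∀ M P Q U y z → M * (P * Q) * (U + P * y) + P * (P * Q) * z ≡ P * (Q * M) * U + P * (P * Q) * (M * y + z)
    collect = solve-∀
    pmu≡ : P * (Q * M) * U ≡ + (p ℕ.* m ℕ.* u)
    pmu≡ = sym (trans (cong (λ x → + (p ℕ.* x ℕ.* u)) m≡) (trans (ℤ.pos-* (p ℕ.* (p ℕ.^ k ℕ.* m′)) u)
             (cong (_* U) (trans (ℤ.pos-* p (p ℕ.^ k ℕ.* m′)) (cong (P *_) (ℤ.pos-* (p ℕ.^ k) m′))))))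
    p^[k+2]≡ : + (p ℕ.^ (k ℕ.+ 2)) ≡ P * (P * Q)
    p^[k+2]≡ = trans (cong (λ e → + (p ℕ.^ e)) (ℕ.+-comm k 2))
                 (trans (ℤ.pos-* p (p ℕ.^ suc k)) (cong (P *_) (ℤ.pos-* p (p ℕ.^ k))))

open import Defs
open import Data.Nat using (ℕ; zero; suc; _+_; _*_; _∸_; _^_; _≤_; _<_)
open import Data.Nat.Divisibility using (_∣_)
open import Data.Nat.Primality using (Prime)
open import Data.Integer using (ℤ; +_; _-_)
open import Data.Integer.Divisibility using () renaming (_∣_ to _∣ℤ_)
open import Data.Product using (_×_; _,_)
open import Relation.Nullary using (¬_)
open import Relation.Binary.PropositionalEquality using (_≡_)

theorem3p5 : (p m : ℕ) → Prime p → 3 ≤ p → 1 ≤ m →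
    -- k = ν_p(m)
    (k : ℕ) → p ^ k ∣ m → ¬ (p ^ (suc k) ∣ m) →
    -- ν_p(d_m(0)) = 0
    (¬ (p ∣ d p m 0)) ×
    ((n s q ns u : ℕ) → 1 ≤ n →
      -- base-p expansion: lowest nonzero digit ns at position s
      n ≡ p ^ s * (ns + p * q) → 1 ≤ ns → ns < p →
      -- u = ns⁻¹ mod p, u ∈ {1,…,p-1}
      1 ≤ u → u < p → p ∣ (u * ns ∸ 1) →
      ((+ (p ^ (k + 2))) ∣ℤ (+ d p m n - + (p * m * u)))
      × (p ^ (k + 1) ∣ d p m n)
      × ¬ (p ^ (k + 2) ∣ d p m n))
theorem3p5 zero      m p-prime () _ k p^k∣m p^[1+k]∤m
theorem3p5 (suc p-1) m p-prime 3≤p _ k p^k∣m p^[1+k]∤m =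
  p∤d[m,0] m , λ n s q ns u 1≤n n≡ 1≤ns ns<p 1≤u u<p p∣uns-1 →
    valuation-of-congruence p-prime {k} {m} {u} (p∤ 1≤u u<p) p^k∣m p^[1+k]∤m (d (suc p-1) m n)
      (d-congruence k p^k∣m n s q ns u 1≤n n≡ 1≤ns ns<p 1≤u p∣uns-1)
  where
  open CoefficientCongruence p-1 p-prime 3≤p using (p∤d[m,0]; d-congruence)
  open BinomialsModPrime.ModPrime p-1 p-prime 3≤p using (p∤)
  open PAdic using (valuation-of-congruence)
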